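{- There is a constant $c>0$ such that for every $n\ge 1$ there exist shape graphs $H_n$ and $K_n$, of size polynomial in $n$, such that $L(H_n)\not\subseteq L(K_n)$ and every graph $G\in L(H_n)\setminus L(K_n)$ has size at least $2^{cn}$.
   Context: Fix a finite set $\Sigma$ of edge labels. An interval $[n;m]$ with $n\in\mathbb N$, $m\in\mathbb N\cup\{\infty\}$, $n\le m$, denotes $\{i\in\mathbb N: n\le i\le m\}$. Define $[n_1;m_1]\oplus[n_2;m_2]=[n_1+n_2;m_1+m_2]$, the empty $\oplus$-sum being $[0;0]$; $\subseteq$ between intervals is set inclusion. The basic intervals are $[1;1]$, $[0;1]$, $[1;\infty]$, $[0;\infty]$. A graph is a tuple $G=(N_G,E_G,\mathsf{source}_G,\mathsf{target}_G,\mathsf{lab}_G,\mathsf{occur}_G)$ with finite sets $N_G$ of nodes and $E_G$ of edges, $\mathsf{source}_G,\mathsf{target}_G:E_G\to N_G$, $\mathsf{lab}_G:E_G\to\Sigma$, and $\mathsf{occur}_G$ assigning an interval to each edge. Let $\mathsf{out}_G(n)=\{e\in E_G:\mathsf{source}_G(e)=n\}$. A graph is simple if every edge has interval $[1;1]$ and no two distinct edges have the same source, target and label. A shape graph is a graph using only basic intervals. The size of a graph is the number of its nodes and edges. For graphs $G,H$, a relation $R\subseteq N_G\times N_H$ is a simulation if for every $(n,m)\in R$ there is a function $\lambda:\mathsf{out}_G(n)\to\mathsf{out}_H(m)$ such that for every $e\in\mathsf{out}_G(n)$: $\mathsf{lab}_G(e)=\mathsf{lab}_H(\lambda(e))$ and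 $(\mathsf{target}_G(e),\mathsf{target}_H(\lambda(e)))\in R$; and for every $f\in\mathsf{out}_H(m)$: $\bigoplus\{\mathsf{occur}_G(e): e\in\mathsf{out}_G(n),\lambda(e)=f\}\subseteq\mathsf{occur}_H(f)$. An embedding is a simulation whose domain is all of $N_G$; write $G\preccurlyeq H$ if one exists. $L(H)$ is the set of simple graphs $G$ with $G\preccurlyeq H$. -}

module Defs where

open import Data.Nat using (ℕ; zero; suc; _+_; _≤_; z≤n; s≤s)
open import Data.Nat.Properties using (+-mono-≤)
open import Data.Fin using (Fin; _≟_)
open import Data.List using (List; []; _∷_; foldr)
open import Data.List using (allFin)
open import Data.Product using (Σ; Σ-syntax; _×_; _,_; proj₁; ∃; ∃-syntax)
open import Data.Sum using (_⊎_)
open import Relation.Nullary using (yes; no; ¬_)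
open import Relation.Binary.PropositionalEquality using (_≡_; refl)

data ℕ∞ : Set where
  fin : ℕ → ℕ∞
  ∞   : ℕ∞

_+∞_ : ℕ∞ → ℕ∞ → ℕ∞
fin a +∞ fin b = fin (a + b)
fin _ +∞ ∞     = ∞
∞     +∞ _     = ∞

data _≤∞_ : ℕ → ℕ∞ → Set where
  ≤fin : ∀ {a b} → a ≤ b → a ≤∞ fin b
  ≤inf : ∀ {a} → a ≤∞ ∞

≤∞-+ : ∀ {a b x y} → a ≤∞ x → b ≤∞ y → (a + b) ≤∞ (x +∞ y)
≤∞-+ (≤fin p) (≤fin q) = ≤fin (+-mono-≤ p q)
≤∞-+ (≤fin _) ≤inf     = ≤inf
≤∞-+ ≤inf     _        = ≤inf

record Interval : Set where
  constructor mkI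
  field
    lo : ℕ
    hi : ℕ∞
    wf : lo ≤∞ hi
open Interval public

_∈I_ : ℕ → Interval → Set
i ∈I I = (lo I ≤ i) × (i ≤∞ hi I)

_⊆I_ : Interval → Interval → Set
I ⊆I J = ∀ i → i ∈I I → i ∈I J

_⊕_ : Interval → Interval → Interval
I ⊕ J = mkI (lo I + lo J) (hi I +∞ hi J) (≤∞-+ (wf I) (wf J))

𝟘I : Interval
𝟘I = mkI (0) (fin 0) (≤fin z≤n)

I11 I01 I1∞ I0∞ : Interval
I11 = mkI (1) (fin 1) (≤fin (s≤s z≤n))
I01 = mkI (0) (fin 1) (≤fin z≤n)
I1∞ = mkI (1) (∞) (≤inf)
I0∞ = mkI (0) (∞) (≤inf)

_≡I_ : Interval → Interval → Set
I ≡I J = (lo I ≡ lo J) × (hi I ≡ hi J)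

IsBasic : Interval → Set
IsBasic I = (I ≡I I11) ⊎ (I ≡I I01) ⊎ (I ≡I I1∞) ⊎ (I ≡I I0∞)

record Graph (s : ℕ) : Set where
  field
    nN     : ℕ
    nE     : ℕ
    source : Fin nE → Fin nN
    target : Fin nE → Fin nN
    lab    : Fin nE → Fin s
    occur  : Fin nE → Interval
open Graph public

size : ∀ {s} → Graph s → ℕ
size G = nN G + nE G

Out : ∀ {s} (G : Graph s) → Fin (nN G) → Set
Out G n = Σ[ e ∈ Fin (nE G) ] source G e ≡ n

IsSimple : ∀ {s} → Graph s → Set
IsSimple G =
  (∀ e → occur G e ≡I I11) ×
  (∀ e e' → source G e ≡ source G e' → target G e ≡ target G e' →
            lab G e ≡ lab G e' → e ≡ e')

IsShape : ∀ {s} → Graph s → Set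
IsShape G = ∀ e → IsBasic (occur G e)

module _ {s} (G H : Graph s) {n : Fin (nN G)} {m : Fin (nN H)}
         (λ' : Out G n → Out H m) (f : Out H m) where

  contrib : Fin (nE G) → Interval
  contrib e with source G e ≟ n
  ... | no _  = 𝟘I
  ... | yes p with proj₁ (λ' (e , p)) ≟ proj₁ f
  ...   | yes _ = occur G e
  ...   | no _  = 𝟘I

  preimageSum : Interval
  preimageSum = foldr (λ e acc → contrib e ⊕ acc) 𝟘I (allFin (nE G))

IsSimulation : ∀ {s} (G H : Graph s) → (Fin (nN G) → Fin (nN H) → Set) → Set
IsSimulation G H R =
  ∀ n m → R n m →
  Σ[ λ' ∈ (Out G n → Out H m) ]
    ((∀ (e : Out G n) →
        (lab G (proj₁ e) ≡ lab H (proj₁ (λ' e))) ×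
        R (target G (proj₁ e)) (target H (proj₁ (λ' e)))) ×
     (∀ (f : Out H m) → preimageSum G H λ' f ⊆I occur H (proj₁ f)))

_≼_ : ∀ {s} → Graph s → Graph s → Set₁
G ≼ H = Σ[ R ∈ (Fin (nN G) → Fin (nN H) → Set) ]
          IsSimulation G H R × (∀ n → ∃[ m ] R n m)

_∈L_ : ∀ {s} → Graph s → Graph s → Set₁
G ∈L H = IsSimple G × G ≼ H

-- H and K are shape graphs built on a chain of length O(n), whose nodes serve as
-- pairwise distinguishable tags.  A simple graph in L(H) consists of counter nodes,
-- each carrying a set of n bits, possibly an end edge and at most one next edge.  Call
-- a counter node good if following next edges counts up in binary, one step at a
-- time, to a node with all bits set and an end edge.  K has a main node for every
-- kind of good nonzero node and for every kind of local defect of a bad node, so a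
-- graph in L(H) embeds into K unless some good node represents 0.  Such a node starts
-- a run through all 2ⁿ values; hence every G ∈ L(H) \ L(K) has at least 2ⁿ nodes.
-- Conversely the counter 0 → 1 → … → 2ⁿ - 1 lies in L(H) but not in L(K): its root
-- represents 0, so only a defect kind could simulate it, and a defect is passed on
-- along the next edges until it contradicts the counter.

module Submission where

open import Defs
open import Axiom.UniquenessOfIdentityProofs using (module Decidable⇒UIP)
open import Data.Bool using (Bool; true; false; not; T; _∨_; _∧_; if_then_else_)
open import Data.Bool.Properties using (⇔→≡; ¬-not; not-¬; not-involutive) renaming (_≟_ to _≟ᵇ_)
open import Data.Empty using (⊥)
open import Data.Fin using (Fin; zero; suc; _≟_; toℕ; fromℕ<; inject₁)
open import Data.Fin.Properties
  using (suc-injective; 0≢1+n; 1↔⊤; 2↔Bool; +↔⊎; *↔×; any?; ∀-cons; inject₁-injective; toℕ-inject₁;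
         injective⇒≤; toℕ-injective; toℕ<n; toℕ-fromℕ<; fromℕ<-cong)
open import Data.List using (List; []; _∷_; foldr; allFin)
import Data.List as List
open import Data.Nat using (ℕ; zero; suc; pred; _+_; _*_; _∸_; _^_; _⊔_; _≤_; _<_; z≤n; s≤s; ⌊_/2⌋; _<?_; _≤?_)
open import Data.Nat.Properties
  using (≤-refl; ≤-reflexive; ≤-trans; ≤-antisym; <⇒≤; <⇒≱; ≰⇒>; ≤-<-trans; <-irrefl; ≤∧≮⇒≡; m≤m+n; m≤n+m; m+n≮m; m≤m⊔n; m≤n⊔m;
         +-suc; +-identityʳ; +-mono-≤; *-mono-≤; *-monoʳ-≤; *-identityʳ; *-identityˡ; *-distribʳ-+;
         ^-monoʳ-≤; ^-identityʳ; ^-distribˡ-+-*; [m*n]*[o*p]≡[m*o]*[n*p]; m+[n∸m]≡n; m^n>0; module ≤-Reasoning)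
  renaming (suc-injective to suc-injectiveℕ)
open import Data.Product using (Σ-syntax; ∃; _×_; _,_; proj₁; proj₂)
open import Data.Product.Function.NonDependent.Propositional using (_×-↔_)
open import Data.Sum using (_⊎_; inj₁; inj₂)
open import Data.Sum.Function.Propositional using (_⊎-↔_)
open import Data.Unit using (⊤; tt)
open import Data.Vec using (Vec; []; _∷_; lookup; head; tail; tabulate)
open import Data.Vec.Properties using (tabulate∘lookup; tabulate-cong; lookup∘tabulate)
open import Effect.Monad using (RawMonad)
open import Function using (_∘_; id; _↔_; Inverse; mk↔ₛ′; _⇔_; mk⇔; Equivalence)
import Function.Properties.Equivalence as ⇔
open import Function.Properties.Inverse using (↔-refl; ↔-sym; ↔-trans)
open import Level using (0ℓ)
open import Relation.Binary.Definitions using (DecidableEquality)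
open import Relation.Binary.PropositionalEquality
  using (_≡_; _≢_; refl; sym; trans; cong; cong₂; subst; subst₂; module ≡-Reasoning)
open import Relation.Nullary using (Dec; yes; no; ¬_; ¬?; does; contradiction)
open import Relation.Nullary.Decidable using (map′; dec-true; dec-false; decidable-stable; ¬¬-excluded-middle)
open import Relation.Nullary.Negation using (¬¬-Monad)

-- Counting preimages

finSum : (N : ℕ) → (Fin N → ℕ) → ℕ
finSum zero    w = 0
finSum (suc N) w = w zero + finSum N (w ∘ suc)

finSum-tabulate : ∀ {A : Set} N (w : A → ℕ) (f : Fin N → A) →
  foldr (λ x acc → w x + acc) 0 (List.tabulate f) ≡ finSum N (w ∘ f)
finSum-tabulate zero    w f = refl
finSum-tabulate (suc N) w f = cong (w (f zero) +_) (finSum-tabulate N w (f ∘ suc))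

finSum-mono : ∀ N {v w : Fin N → ℕ} → (∀ e → v e ≤ w e) → finSum N v ≤ finSum N w
finSum-mono zero    v≤w = z≤n
finSum-mono (suc N) v≤w = +-mono-≤ (v≤w zero) (finSum-mono N (v≤w ∘ suc))

finSum-pos : ∀ N (w : Fin N → ℕ) e → 1 ≤ w e → 1 ≤ finSum N w
finSum-pos (suc N) w zero    p = ≤-trans p (m≤m+n (w zero) _)
finSum-pos (suc N) w (suc e) p = ≤-trans (finSum-pos N (w ∘ suc) e p) (m≤n+m _ (w zero))

finSum≥2 : ∀ N (w : Fin N → ℕ) {e e'} → ¬ e ≡ e' → 1 ≤ w e → 1 ≤ w e' → 2 ≤ finSum N w
finSum≥2 (suc N) w {zero}  {zero}   e≢e' p q = contradiction refl e≢e'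
finSum≥2 (suc N) w {zero}  {suc e'} e≢e' p q = +-mono-≤ p (finSum-pos N (w ∘ suc) e' q)
finSum≥2 (suc N) w {suc e} {zero}   e≢e' p q = +-mono-≤ q (finSum-pos N (w ∘ suc) e p)
finSum≥2 (suc N) w {suc e} {suc e'} e≢e' p q =
  ≤-trans (finSum≥2 N (w ∘ suc) (e≢e' ∘ cong suc) p q) (m≤n+m _ (w zero))

finSum-pos⁻¹ : ∀ N (w : Fin N → ℕ) → 1 ≤ finSum N w → ∃ λ e → 1 ≤ w e
finSum-pos⁻¹ (suc N) w p with w zero in eq
... | suc _ = zero , subst (1 ≤_) (sym eq) (s≤s z≤n)
... | zero  = let e , q = finSum-pos⁻¹ N (w ∘ suc) p in suc e , q

finSum-zero : ∀ N (w : Fin N → ℕ) → (∀ e → ¬ 1 ≤ w e) → finSum N w ≡ 0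
finSum-zero zero    w w≡0 = refl
finSum-zero (suc N) w w≡0 with w zero | w≡0 zero
... | zero  | _     = finSum-zero N (w ∘ suc) (w≡0 ∘ suc)
... | suc _ | w0≢0  = contradiction (s≤s z≤n) w0≢0

finSum≤1 : ∀ N (w : Fin N → ℕ) → (∀ e → w e ≤ 1) →
  (∀ e e' → 1 ≤ w e → 1 ≤ w e' → e ≡ e') → finSum N w ≤ 1
finSum≤1 zero    w w≤1 unique = z≤n
finSum≤1 (suc N) w w≤1 unique with w zero | w≤1 zero | (λ e → unique zero (suc e))
... | zero  | _       | _    =
  finSum≤1 N (w ∘ suc) (w≤1 ∘ suc) (λ e e' p q → suc-injective (unique (suc e) (suc e') p q))
... | suc _ | s≤s z≤n | only =
  subst (λ x → suc x ≤ 1) (sym (finSum-zero N (w ∘ suc) λ e p → 0≢1+n (only e (s≤s z≤n) p))) ≤-refl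

-- For a simple source graph every edge carries [1;1], so the preimage sum of f
-- is the one-point interval [k;k] with k the number of preimages of f.
module PreimageCount {s} (G H : Graph s) (G-simple : IsSimple G) {n : Fin (nN G)} {m : Fin (nN H)}
                     (λ' : Out G n → Out H m) (f : Out H m) where

  IsPreimage : Fin (nE G) → Set
  IsPreimage e = Σ[ p ∈ source G e ≡ n ] proj₁ (λ' (e , p)) ≡ proj₁ f

  indicator : Fin (nE G) → ℕ
  indicator e = lo (contrib G H λ' f e)

  count : ℕ
  count = finSum (nE G) indicator

  private
    contrib-cases : ∀ e → (IsPreimage e × indicator e ≡ 1 × hi (contrib G H λ' f e) ≡ fin 1)
                        ⊎ (¬ IsPreimage e × indicator e ≡ 0 × hi (contrib G H λ' f e) ≡ fin 0)
    contrib-cases e with source G e ≟ n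
    ... | no ¬p = inj₂ ((λ (p , _) → ¬p p) , refl , refl)
    ... | yes p with proj₁ (λ' (e , p)) ≟ proj₁ f
    ...   | yes q = inj₁ ((p , q) , proj₁ G-simple e)
    ...   | no ¬q = inj₂ ((λ (p' , q) → ¬q (subst (λ r → proj₁ (λ' (e , r)) ≡ proj₁ f)
                                                      (Decidable⇒UIP.≡-irrelevant _≟_ p' p) q))
                         , refl , refl)

    Sum : List (Fin (nE G)) → Interval
    Sum = foldr (λ e acc → contrib G H λ' f e ⊕ acc) 𝟘I

    lo-Sum : ∀ xs → lo (Sum xs) ≡ foldr (λ e acc → indicator e + acc) 0 xs
    lo-Sum []       = refl
    lo-Sum (x ∷ xs) = cong (indicator x +_) (lo-Sum xs)

    hi-Sum : ∀ xs → hi (Sum xs) ≡ fin (foldr (λ e acc → indicator e + acc) 0 xs)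
    hi-Sum []       = refl
    hi-Sum (x ∷ xs) with contrib-cases x
    ... | inj₁ (_ , w≡1 , h≡1) rewrite hi-Sum xs | w≡1 | h≡1 = refl
    ... | inj₂ (_ , w≡0 , h≡0) rewrite hi-Sum xs | w≡0 | h≡0 = refl

  lo-preimageSum : lo (preimageSum G H λ' f) ≡ count
  lo-preimageSum = trans (lo-Sum (allFin (nE G))) (finSum-tabulate (nE G) indicator id)

  hi-preimageSum : hi (preimageSum G H λ' f) ≡ fin count
  hi-preimageSum = trans (hi-Sum (allFin (nE G))) (cong fin (finSum-tabulate (nE G) indicator id))

  preimageSum⊆⇒count∈ : ∀ {J} → preimageSum G H λ' f ⊆I J → count ∈I J
  preimageSum⊆⇒count∈ sub =
    sub count (subst (_≤ count) (sym lo-preimageSum) ≤-refl , subst (count ≤∞_) (sym hi-preimageSum) (≤fin ≤-refl))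

  count∈⇒preimageSum⊆ : ∀ {J} → count ∈I J → preimageSum G H λ' f ⊆I J
  count∈⇒preimageSum⊆ {J} count∈J i (lo≤i , i≤hi) = subst (_∈I J) (≤-antisym count≤i i≤count) count∈J
    where
    count≤i : count ≤ i
    count≤i = subst (_≤ i) lo-preimageSum lo≤i
    i≤count : i ≤ count
    i≤count with subst (i ≤∞_) hi-preimageSum i≤hi
    ... | ≤fin q = q

  indicator≤1 : ∀ e → indicator e ≤ 1
  indicator≤1 e with contrib-cases e
  ... | inj₁ (_ , w≡1 , _) rewrite w≡1 = ≤-refl
  ... | inj₂ (_ , w≡0 , _) rewrite w≡0 = z≤n

  preimage⇒indicator : ∀ e → IsPreimage e → 1 ≤ indicator e
  preimage⇒indicator e pe with contrib-cases e
  ... | inj₁ (_ , w≡1 , _) rewrite w≡1 = ≤-refl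
  ... | inj₂ (¬pe , _ , _) = contradiction pe ¬pe

  indicator⇒preimage : ∀ e → 1 ≤ indicator e → IsPreimage e
  indicator⇒preimage e p with contrib-cases e
  ... | inj₁ (pe , _ , _) = pe
  ... | inj₂ (_ , w≡0 , _) rewrite w≡0 with p
  ...   | ()

  count-pos : ∀ e → IsPreimage e → 1 ≤ count
  count-pos e pe = finSum-pos (nE G) indicator e (preimage⇒indicator e pe)

  count-pos⁻¹ : 1 ≤ count → ∃ IsPreimage
  count-pos⁻¹ p = let e , q = finSum-pos⁻¹ (nE G) indicator p in e , indicator⇒preimage e q

  count≥2 : ∀ {e e'} → ¬ e ≡ e' → IsPreimage e → IsPreimage e' → 2 ≤ count
  count≥2 e≢e' pe pe' = finSum≥2 (nE G) indicator e≢e' (preimage⇒indicator _ pe) (preimage⇒indicator _ pe')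

  count≤1 : (∀ e e' → IsPreimage e → IsPreimage e' → e ≡ e') → count ≤ 1
  count≤1 unique = finSum≤1 (nE G) indicator indicator≤1
    (λ e e' p q → unique e e' (indicator⇒preimage e p) (indicator⇒preimage e' q))

  count≤1-injective : (∀ e e' → proj₁ (λ' e) ≡ proj₁ (λ' e') → proj₁ e ≡ proj₁ e') → count ≤ 1
  count≤1-injective inj = count≤1 λ e e' (p , q) (p' , q') → inj (e , p) (e' , p') (trans q (sym q'))

module _ {s} (G H₁ H₂ : Graph s) (G-simple : IsSimple G) {n : Fin (nN G)} {m₁ : Fin (nN H₁)} {m₂ : Fin (nN H₂)}
         (λ₁ : Out G n → Out H₁ m₁) (f₁ : Out H₁ m₁) (λ₂ : Out G n → Out H₂ m₂) (f₂ : Out H₂ m₂) where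
  private
    module C₁ = PreimageCount G H₁ G-simple λ₁ f₁
    module C₂ = PreimageCount G H₂ G-simple λ₂ f₂

  count-mono : (∀ e → C₁.IsPreimage e → C₂.IsPreimage e) → C₁.count ≤ C₂.count
  count-mono sub = finSum-mono (nE G) pointwise
    where
    pointwise : ∀ e → C₁.indicator e ≤ C₂.indicator e
    pointwise e with C₁.indicator e | C₁.indicator≤1 e | C₁.indicator⇒preimage e
    ... | zero  | _       | _      = z≤n
    ... | suc _ | s≤s z≤n | toPre = C₂.preimage⇒indicator e (sub e (toPre (s≤s z≤n)))

-- Finite enumerations

record Finite (A : Set) : Set where
  field
    card  : ℕ
    index : A ↔ Fin card

  encode : A → Fin card
  encode = Inverse.to index

  decode : Fin card → A
  decode = Inverse.from index

  decode-encode : ∀ a → decode (encode a) ≡ a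
  decode-encode = Inverse.strictlyInverseʳ index

  encode-decode : ∀ i → encode (decode i) ≡ i
  encode-decode = Inverse.strictlyInverseˡ index

  encode-injective : ∀ {a b} → encode a ≡ encode b → a ≡ b
  encode-injective {a} {b} eq = trans (sym (decode-encode a)) (trans (cong decode eq) (decode-encode b))
open Finite public

finite-≟ : ∀ {A} → Finite A → DecidableEquality A
finite-≟ F a b = map′ (encode-injective F) (cong (encode F)) (encode F a ≟ encode F b)

finiteFin : ∀ k → Finite (Fin k)
finiteFin k = record { card = k ; index = ↔-refl }

finite⊤ : Finite ⊤
finite⊤ = record { card = 1 ; index = ↔-sym 1↔⊤ }

finiteBool : Finite Bool
finiteBool = record { card = 2 ; index = ↔-sym 2↔Bool }

_⊎ᶠ_ : ∀ {A B} → Finite A → Finite B → Finite (A ⊎ B)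
FA ⊎ᶠ FB = record { card = card FA + card FB ; index = ↔-trans (index FA ⊎-↔ index FB) (↔-sym +↔⊎) }

_×ᶠ_ : ∀ {A B} → Finite A → Finite B → Finite (A × B)
FA ×ᶠ FB = record { card = card FA * card FB ; index = ↔-trans (index FA ×-↔ index FB) (↔-sym *↔×) }

finite-↔ : ∀ {A B} → Finite A → B ↔ A → Finite B
finite-↔ FA B↔A = record { card = card FA ; index = ↔-trans B↔A (index FA) }

-- Shape graphs on a chain

-- Both shape graphs consist of a chain, a dead node and main nodes.  The chain is a
-- path c_L → … → c_0; a node simulated by c_a starts a path of exactly a edges, so
-- chain nodes act as pairwise distinguishable tags for the targets of main edges.

data Tag (n : ℕ) : Set where
  markTag : Bool → Tag n
  bitTag  : Fin n → Bool → Tag n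
  endTag  : Tag n

finiteTag : ∀ {n} → Finite (Tag n)
finiteTag {n} = finite-↔ (finiteBool ⊎ᶠ ((finiteFin n ×ᶠ finiteBool) ⊎ᶠ finite⊤)) (mk↔ₛ′ to from to-from from-to)
  where
  to : Tag n → Bool ⊎ ((Fin n × Bool) ⊎ ⊤)
  to (markTag b)  = inj₁ b
  to (bitTag i v) = inj₂ (inj₁ (i , v))
  to endTag       = inj₂ (inj₂ tt)
  from : Bool ⊎ ((Fin n × Bool) ⊎ ⊤) → Tag n
  from (inj₁ b)              = markTag b
  from (inj₂ (inj₁ (i , v))) = bitTag i v
  from (inj₂ (inj₂ _))       = endTag
  to-from : ∀ x → to (from x) ≡ x
  to-from (inj₁ b)              = refl
  to-from (inj₂ (inj₁ (i , v))) = refl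
  to-from (inj₂ (inj₂ tt))      = refl
  from-to : ∀ t → from (to t) ≡ t
  from-to (markTag b)  = refl
  from-to (bitTag i v) = refl
  from-to endTag       = refl

ChainLength : ℕ → ℕ
ChainLength n = card (finiteTag {n})

tagIndex : ∀ {n} → Tag n → Fin (ChainLength n)
tagIndex = encode finiteTag

tagIndex-injective : ∀ {n} {t t' : Tag n} → tagIndex t ≡ tagIndex t' → t ≡ t'
tagIndex-injective = encode-injective finiteTag

-- An edge with requirement r towards x: required is [1;1], optional is [0;1], and
-- forbidden is [0;1] towards the dead node, which no real edge can be mapped to.
data Req : Set where
  required optional forbidden : Req

record Spec (n M : ℕ) : Set where
  field
    bitReq  : Fin n → Req
    endReq  : Req
    nextReq : Fin M → Req
open Spec public

data Slot (n M : ℕ) : Set where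
  tag  : Tag n → Slot n M
  next : Fin M → Slot n M

pattern mark b  = tag (markTag b)
pattern bit i v = tag (bitTag i v)
pattern end     = tag endTag

data Node (n M : ℕ) : Set where
  chain : Fin (ChainLength n) → Node n M
  dead  : Node n M
  main  : Fin M → Node n M

data Edge (n M : ℕ) : Set where
  chainEdge : Fin (pred (ChainLength n)) → Edge n M
  deadLoop  : Edge n M
  slotEdge  : Fin M → Slot n M → Edge n M

slotEdge-injective : ∀ {n M} {μ ν : Fin M} {a b : Slot n M} → slotEdge μ a ≡ slotEdge ν b → a ≡ b
slotEdge-injective refl = refl

tagNode : ∀ {n M} → Tag n → Node n M
tagNode t = chain (tagIndex t)

reqTarget : ∀ {n M} → Req → Node n M → Node n M
reqTarget required  x = x
reqTarget optional  x = x
reqTarget forbidden x = dead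

reqOccur : Req → Interval
reqOccur required  = I11
reqOccur optional  = I01
reqOccur forbidden = I01

Meets : Req → Set → Set
Meets required  P = P
Meets optional  P = ⊤
Meets forbidden P = ¬ P

reqTarget-allowed : ∀ {n M} r {X : Node n M} → ¬ r ≡ forbidden → reqTarget r X ≡ X
reqTarget-allowed required  _ = refl
reqTarget-allowed optional  _ = refl
reqTarget-allowed forbidden f = contradiction refl f

meets-allowed : ∀ r {P} → Meets r P → P → ¬ r ≡ forbidden
meets-allowed forbidden ¬p p _ = ¬p p

reqOccur⇒≤1 : ∀ r {k} → k ∈I reqOccur r → k ≤ 1
reqOccur⇒≤1 required  (_ , ≤fin k≤1) = k≤1
reqOccur⇒≤1 optional  (_ , ≤fin k≤1) = k≤1
reqOccur⇒≤1 forbidden (_ , ≤fin k≤1) = k≤1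

≤1⇒reqOccur : ∀ r {k} → k ≤ 1 → (r ≡ required → 1 ≤ k) → k ∈I reqOccur r
≤1⇒reqOccur required  k≤1 pos = pos refl , ≤fin k≤1
≤1⇒reqOccur optional  k≤1 _   = z≤n , ≤fin k≤1
≤1⇒reqOccur forbidden k≤1 _   = z≤n , ≤fin k≤1

slotReq : ∀ {n M} → Spec n M → Slot n M → Req
slotReq sp (mark _)      = required
slotReq sp (bit i false) = optional
slotReq sp (bit i true)  = bitReq sp i
slotReq sp end           = endReq sp
slotReq sp (next ν)      = nextReq sp ν

slotNode : ∀ {n M} → Slot n M → Node n M
slotNode (tag t)  = tagNode t
slotNode (next ν) = main ν

chain-injective : ∀ {n M} {a b : Fin (ChainLength n)} → chain {n} {M} a ≡ chain b → a ≡ b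
chain-injective refl = refl

slotNode-injective : ∀ {n M} {sl sl' : Slot n M} → slotNode sl ≡ slotNode sl' → sl ≡ sl'
slotNode-injective {sl = tag t}  {tag t'}  eq = cong tag (tagIndex-injective (chain-injective eq))
slotNode-injective {sl = next ν} {next ν'} refl = refl

module _ {n M : ℕ} where

  finiteSlot : Finite (Slot n M)
  finiteSlot = finite-↔ (finiteTag ⊎ᶠ finiteFin M) (mk↔ₛ′ to from to-from from-to)
    where
    to : Slot n M → Tag n ⊎ Fin M
    to (tag t)  = inj₁ t
    to (next ν) = inj₂ ν
    from : Tag n ⊎ Fin M → Slot n M
    from (inj₁ t) = tag t
    from (inj₂ ν) = next ν
    to-from : ∀ x → to (from x) ≡ x
    to-from (inj₁ t) = refl
    to-from (inj₂ ν) = refl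
    from-to : ∀ x → from (to x) ≡ x
    from-to (tag t)  = refl
    from-to (next ν) = refl

  finiteNode : Finite (Node n M)
  finiteNode = finite-↔ (finiteFin (ChainLength n) ⊎ᶠ (finite⊤ ⊎ᶠ finiteFin M)) (mk↔ₛ′ to from to-from from-to)
    where
    to : Node n M → Fin (ChainLength n) ⊎ (⊤ ⊎ Fin M)
    to (chain a) = inj₁ a
    to dead      = inj₂ (inj₁ tt)
    to (main μ)  = inj₂ (inj₂ μ)
    from : Fin (ChainLength n) ⊎ (⊤ ⊎ Fin M) → Node n M
    from (inj₁ a)        = chain a
    from (inj₂ (inj₁ _)) = dead
    from (inj₂ (inj₂ μ)) = main μ
    to-from : ∀ x → to (from x) ≡ x
    to-from (inj₁ a)         = refl
    to-from (inj₂ (inj₁ tt)) = refl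
    to-from (inj₂ (inj₂ μ))  = refl
    from-to : ∀ x → from (to x) ≡ x
    from-to (chain a) = refl
    from-to dead      = refl
    from-to (main μ)  = refl

  finiteEdge : Finite (Edge n M)
  finiteEdge = finite-↔ (finiteFin (pred (ChainLength n)) ⊎ᶠ (finite⊤ ⊎ᶠ (finiteFin M ×ᶠ finiteSlot)))
                        (mk↔ₛ′ to from to-from from-to)
    where
    to : Edge n M → Fin (pred (ChainLength n)) ⊎ (⊤ ⊎ (Fin M × Slot n M))
    to (chainEdge a)   = inj₁ a
    to deadLoop        = inj₂ (inj₁ tt)
    to (slotEdge μ sl) = inj₂ (inj₂ (μ , sl))
    from : Fin (pred (ChainLength n)) ⊎ (⊤ ⊎ (Fin M × Slot n M)) → Edge n M
    from (inj₁ a)               = chainEdge a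
    from (inj₂ (inj₁ _))        = deadLoop
    from (inj₂ (inj₂ (μ , sl))) = slotEdge μ sl
    to-from : ∀ x → to (from x) ≡ x
    to-from (inj₁ a)               = refl
    to-from (inj₂ (inj₁ tt))       = refl
    to-from (inj₂ (inj₂ (μ , sl))) = refl
    from-to : ∀ x → from (to x) ≡ x
    from-to (chainEdge a)   = refl
    from-to deadLoop        = refl
    from-to (slotEdge μ sl) = refl

module ShapeGraph (s n M : ℕ) (spec : Fin M → Spec n M) where

  nodes : Finite (Node n M)
  nodes = finiteNode

  edges : Finite (Edge n M)
  edges = finiteEdge

  edgeSource : Edge n M → Node n M
  edgeSource (chainEdge a)  = chain (suc a)
  edgeSource deadLoop       = dead
  edgeSource (slotEdge μ _) = main μ

  edgeTarget : Edge n M → Node n M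
  edgeTarget (chainEdge a)   = chain (inject₁ a)
  edgeTarget deadLoop        = dead
  edgeTarget (slotEdge μ sl) = reqTarget (slotReq (spec μ) sl) (slotNode sl)

  edgeOccur : Edge n M → Interval
  edgeOccur (chainEdge a)   = I11
  edgeOccur deadLoop        = I11
  edgeOccur (slotEdge μ sl) = reqOccur (slotReq (spec μ) sl)

  graph : Graph (suc s)
  graph = record
    { nN     = card nodes
    ; nE     = card edges
    ; source = encode nodes ∘ edgeSource ∘ decode edges
    ; target = encode nodes ∘ edgeTarget ∘ decode edges
    ; lab    = λ _ → zero
    ; occur  = edgeOccur ∘ decode edges }

  node : Node n M → Fin (nN graph)
  node = encode nodes

  reqOccur-basic : ∀ r → IsBasic (reqOccur r)
  reqOccur-basic required  = inj₁ (refl , refl)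
  reqOccur-basic optional  = inj₂ (inj₁ (refl , refl))
  reqOccur-basic forbidden = inj₂ (inj₁ (refl , refl))

  edgeOccur-basic : ∀ x → IsBasic (edgeOccur x)
  edgeOccur-basic (chainEdge a)   = inj₁ (refl , refl)
  edgeOccur-basic deadLoop        = inj₁ (refl , refl)
  edgeOccur-basic (slotEdge μ sl) = reqOccur-basic (slotReq (spec μ) sl)

  graph-shape : IsShape graph
  graph-shape e = edgeOccur-basic (decode edges e)

  outEdge : (x : Edge n M) → Out graph (node (edgeSource x))
  outEdge x = encode edges x , cong (node ∘ edgeSource) (decode-encode edges x)

  outEdge-source : ∀ {X} (f : Out graph (node X)) → edgeSource (decode edges (proj₁ f)) ≡ X
  outEdge-source f = encode-injective nodes (proj₂ f)

  source-chain₀ : ∀ x → ¬ edgeSource x ≡ chain zero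
  source-chain₀ (chainEdge a) ()
  source-chain₀ deadLoop ()
  source-chain₀ (slotEdge _ _) ()

  source-chainSuc : ∀ x {a} → edgeSource x ≡ chain (suc a) → x ≡ chainEdge a
  source-chainSuc (chainEdge a) refl = refl

  source-dead : ∀ x → edgeSource x ≡ dead → x ≡ deadLoop
  source-dead deadLoop refl = refl

  source-main : ∀ x {μ} → edgeSource x ≡ main μ → ∃ λ sl → x ≡ slotEdge μ sl
  source-main (slotEdge μ sl) refl = sl , refl

  module Simulated {G : Graph (suc s)} (G-simple : IsSimple G)
                   {R : Fin (nN G) → Fin (nN graph) → Set} (sim : IsSimulation G graph R) where

    -- y ~ X is R y (node X), wrapped in a record so that X can be inferred from it.
    record _~_ (y : Fin (nN G)) (X : Node n M) : Set where
      constructor ⟨_⟩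
      field related : R y (node X)
    open _~_ public

    edgeMap : ∀ {y X} → y ~ X → Out G y → Out graph (node X)
    edgeMap {y} {X} r = proj₁ (sim y (node X) (related r))

    image : ∀ {y X} → y ~ X → Out G y → Edge n M
    image r e = decode edges (proj₁ (edgeMap r e))

    image-source : ∀ {y X} (r : y ~ X) e → edgeSource (image r e) ≡ X
    image-source r e = outEdge-source (edgeMap r e)

    image-target : ∀ {y X} (r : y ~ X) (e : Out G y) → target G (proj₁ e) ~ edgeTarget (image r e)
    image-target {y} {X} r e = ⟨ proj₂ (proj₁ (proj₂ (sim y (node X) (related r))) e) ⟩

    image-target′ : ∀ {y X} (r : y ~ X) (e : Out G y) {x} → image r e ≡ x → target G (proj₁ e) ~ edgeTarget x
    image-target′ r e eq = subst (λ x → _ ~ edgeTarget x) eq (image-target r e)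

    label≡ : ∀ {y X} (r : y ~ X) (e : Out G y) → lab G (proj₁ e) ≡ zero
    label≡ {y} {X} r e = proj₁ (proj₁ (proj₂ (sim y (node X) (related r))) e)

    module Count {y X} (r : y ~ X) (f : Out graph (node X)) = PreimageCount G graph G-simple (edgeMap r) f

    count∈occur : ∀ {y} x (r : y ~ edgeSource x) → Count.count r (outEdge x) ∈I edgeOccur x
    count∈occur {y} x r = subst (λ z → Count.count r (outEdge x) ∈I edgeOccur z) (decode-encode edges x)
      (Count.preimageSum⊆⇒count∈ r (outEdge x) {occur graph (encode edges x)}
        (proj₂ (proj₂ (sim y (node (edgeSource x)) (related r))) (outEdge x)))

    image⇒preimage : ∀ {y} x (r : y ~ edgeSource x) (e : Out G y) → image r e ≡ x →
                     Count.IsPreimage r (outEdge x) (proj₁ e)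
    image⇒preimage x r (e , p) eq = p , trans (sym (encode-decode edges _)) (cong (encode edges) eq)

    preimage⇒image : ∀ {y} x (r : y ~ edgeSource x) e → Count.IsPreimage r (outEdge x) e →
                     Σ[ p ∈ source G e ≡ y ] image r (e , p) ≡ x
    preimage⇒image x r e (p , q) = p , trans (cong (decode edges) q) (decode-encode edges x)

    preimage-exists : ∀ {y} x (r : y ~ edgeSource x) → 1 ≤ Count.count r (outEdge x) → Σ[ e ∈ Out G y ] image r e ≡ x
    preimage-exists x r p =
      let e , pe = Count.count-pos⁻¹ r (outEdge x) p
          q , eq = preimage⇒image x r e pe
      in (e , q) , eq

    preimage-unique : ∀ {y} x (r : y ~ edgeSource x) → Count.count r (outEdge x) ≤ 1 →
                      ∀ (e e' : Out G y) → image r e ≡ x → image r e' ≡ x → proj₁ e ≡ proj₁ e'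
    preimage-unique x r ≤1 e e' q q' = decidable-stable (proj₁ e ≟ proj₁ e') λ e≢e' →
      contradiction (≤-trans (Count.count≥2 r (outEdge x) e≢e' (image⇒preimage x r e q) (image⇒preimage x r e' q')) ≤1)
                    λ { (s≤s ()) }

    image-irrelevant : ∀ {y X} (r : y ~ X) (e e' : Out G y) → proj₁ e ≡ proj₁ e' → image r e ≡ image r e'
    image-irrelevant r (a , p) (.a , p') refl = cong (λ p → image r (a , p)) (Decidable⇒UIP.≡-irrelevant _≟_ p p')

    image-dec : ∀ {y X} (r : y ~ X) x → Dec (Σ[ e ∈ Out G y ] image r e ≡ x)
    image-dec {y} r x = map′ (λ (e , p , q) → (e , p) , q) (λ ((e , p) , q) → e , p , q) (any? imageAt?)
      where
      imageAt? : ∀ e → Dec (Σ[ p ∈ source G e ≡ y ] image r (e , p) ≡ x)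
      imageAt? e with source G e ≟ y
      ... | no ¬p = no (¬p ∘ proj₁)
      ... | yes p = map′ (p ,_) (λ (p' , q) → trans (image-irrelevant r (e , p) (e , p') refl) q)
                         (finite-≟ edges (image r (e , p)) x)

    required-preimage : ∀ {y} x (r : y ~ edgeSource x) → edgeOccur x ≡ I11 → Σ[ e ∈ Out G y ] image r e ≡ x
    required-preimage x r eq =
      preimage-exists x r (proj₁ (subst (Count.count r (outEdge x) ∈I_) eq (count∈occur x r)))

    chain₀-noOut : ∀ {y} → y ~ chain zero → ¬ Out G y
    chain₀-noOut r e = source-chain₀ _ (image-source r e)

    chainSuc-image : ∀ {y a} (r : y ~ chain (suc a)) e → image r e ≡ chainEdge a
    chainSuc-image r e = source-chainSuc _ (image-source r e)

    chainSuc-target : ∀ {y a} → y ~ chain (suc a) → ∀ e → target G (proj₁ e) ~ chain (inject₁ a)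
    chainSuc-target r e = image-target′ r e (chainSuc-image r e)

    chainSuc-out : ∀ {y a} → y ~ chain (suc a) → Out G y
    chainSuc-out {a = a} r = proj₁ (required-preimage (chainEdge a) r refl)

    chainSuc-unique : ∀ {y a} → y ~ chain (suc a) → ∀ (e e' : Out G y) → proj₁ e ≡ proj₁ e'
    chainSuc-unique {a = a} r e e' =
      preimage-unique (chainEdge a) r (reqOccur⇒≤1 required (count∈occur (chainEdge a) r)) e e'
                      (chainSuc-image r e) (chainSuc-image r e')

    dead-image : ∀ {y} (r : y ~ dead) e → image r e ≡ deadLoop
    dead-image r e = source-dead _ (image-source r e)

    dead-target : ∀ {y} → y ~ dead → ∀ e → target G (proj₁ e) ~ dead
    dead-target r e = image-target′ r e (dead-image r e)

    dead-out : ∀ {y} → y ~ dead → Out G y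
    dead-out r = proj₁ (required-preimage deadLoop r refl)

    dead-unique : ∀ {y} → y ~ dead → ∀ (e e' : Out G y) → proj₁ e ≡ proj₁ e'
    dead-unique r e e' =
      preimage-unique deadLoop r (reqOccur⇒≤1 required (count∈occur deadLoop r)) e e' (dead-image r e) (dead-image r e')

    main-slot : ∀ {y μ} (r : y ~ main μ) e → ∃ λ sl → image r e ≡ slotEdge μ sl
    main-slot r e = source-main _ (image-source r e)

    -- The two mark edges of a main node are required.
    main-twoOut : ∀ {y μ} → y ~ main μ → Σ[ e ∈ Out G y ] Σ[ e' ∈ Out G y ] ¬ proj₁ e ≡ proj₁ e'
    main-twoOut {y} {μ} r = proj₁ mark₀ , proj₁ mark₁ , λ eq → mark₀≢mark₁
      (trans (sym (proj₂ mark₀)) (trans (image-irrelevant r (proj₁ mark₀) (proj₁ mark₁) eq) (proj₂ mark₁)))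
      where
      mark₀ = required-preimage (slotEdge μ (mark false)) r refl
      mark₁ = required-preimage (slotEdge μ (mark true)) r refl
      mark₀≢mark₁ : ¬ slotEdge {n} {M} μ (mark false) ≡ slotEdge μ (mark true)
      mark₀≢mark₁ ()

    main-notSingleOut : ∀ {y μ} → y ~ main μ → ¬ (∀ (e e' : Out G y) → proj₁ e ≡ proj₁ e')
    main-notSingleOut r unique = let e , e' , e≢e' = main-twoOut r in e≢e' (unique e e')

    chain-main-disjoint : ∀ {y a μ} → y ~ chain a → ¬ y ~ main μ
    chain-main-disjoint {a = zero}  r r' = chain₀-noOut r (proj₁ (main-twoOut r'))
    chain-main-disjoint {a = suc a} r r' = main-notSingleOut r' (chainSuc-unique r)

    dead-main-disjoint : ∀ {y μ} → y ~ dead → ¬ y ~ main μ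
    dead-main-disjoint r r' = main-notSingleOut r' (dead-unique r)

    -- The chain is descended by recursion on toℕ a: inject₁ a is no structural subterm of suc a.
    chain-dead-disjoint : ∀ {y} a → y ~ chain a → ¬ y ~ dead
    chain-dead-disjoint a = go a refl
      where
      go : ∀ {k y} a → toℕ a ≡ k → y ~ chain a → ¬ y ~ dead
      go zero    _  r r' = chain₀-noOut r (dead-out r')
      go {suc k} (suc a) eq r r' =
        go (inject₁ a) (trans (toℕ-inject₁ a) (suc-injectiveℕ eq)) (chainSuc-target r e) (dead-target r' e)
        where e = dead-out r'

    chain-functional : ∀ {y} a b → y ~ chain a → y ~ chain b → a ≡ b
    chain-functional a b = go a b refl
      where
      go : ∀ {k y} a b → toℕ a ≡ k → y ~ chain a → y ~ chain b → a ≡ b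
      go zero    zero    _ r r' = refl
      go zero    (suc b) _ r r' = contradiction (chainSuc-out r') (chain₀-noOut r)
      go (suc a) zero    _ r r' = contradiction (chainSuc-out r) (chain₀-noOut r')
      go {suc k} (suc a) (suc b) eq r r' = cong suc (inject₁-injective
        (go (inject₁ a) (inject₁ b) (trans (toℕ-inject₁ a) (suc-injectiveℕ eq)) (chainSuc-target r e) (chainSuc-target r' e)))
        where e = chainSuc-out r

-- Binary counters

vec-ext : ∀ {A : Set} {n} {u v : Vec A n} → (∀ i → lookup u i ≡ lookup v i) → u ≡ v
vec-ext {u = u} {v} eq = trans (sym (tabulate∘lookup u)) (trans (tabulate-cong eq) (tabulate∘lookup v))

increment : ∀ {n} → Vec Bool n → Vec Bool n
increment []          = []
increment (false ∷ u) = true ∷ u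
increment (true ∷ u)  = false ∷ increment u

carry : ∀ {n} → Vec Bool n → Fin n → Bool
carry (b ∷ u) zero    = true
carry (b ∷ u) (suc i) = b ∧ carry u i

increment-carry : ∀ {n} (u : Vec Bool n) i → carry u i ≡ true → lookup (increment u) i ≡ not (lookup u i)
increment-carry (false ∷ u) zero    _ = refl
increment-carry (true ∷ u)  zero    _ = refl
increment-carry (true ∷ u)  (suc i) c = increment-carry u i c

increment-noCarry : ∀ {n} (u : Vec Bool n) i → carry u i ≡ false → lookup (increment u) i ≡ lookup u i
increment-noCarry (false ∷ u) (suc i) _ = refl
increment-noCarry (true ∷ u)  (suc i) c = increment-noCarry u i c

carry-true⇒ : ∀ {n} (u : Vec Bool n) i → carry u i ≡ true → ∀ j → toℕ j < toℕ i → lookup u j ≡ true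
carry-true⇒ (true ∷ u)  (suc i) c zero    _         = refl
carry-true⇒ (true ∷ u)  (suc i) c (suc j) (s≤s j<i) = carry-true⇒ u i c j j<i

carry-false⇒ : ∀ {n} (u : Vec Bool n) i → carry u i ≡ false → ∃ λ j → toℕ j < toℕ i × lookup u j ≡ false
carry-false⇒ (false ∷ u) (suc i) c = zero , s≤s z≤n , refl
carry-false⇒ (true ∷ u)  (suc i) c =
  let j , j<i , uj = carry-false⇒ u i c in suc j , s≤s j<i , uj

carry-true⇐ : ∀ {n} (u : Vec Bool n) i → (∀ j → toℕ j < toℕ i → lookup u j ≡ true) → carry u i ≡ true
carry-true⇐ (b ∷ u) zero    below = refl
carry-true⇐ (b ∷ u) (suc i) below rewrite below zero (s≤s z≤n) = carry-true⇐ u i (λ j j<i → below (suc j) (s≤s j<i))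

carry-false⇐ : ∀ {n} (u : Vec Bool n) i j → toℕ j < toℕ i → lookup u j ≡ false → carry u i ≡ false
carry-false⇐ (b ∷ u)     (suc i) zero    _         uj rewrite uj = refl
carry-false⇐ (false ∷ u) (suc i) (suc j) _         uj = refl
carry-false⇐ (true ∷ u)  (suc i) (suc j) (s≤s j<i) uj = carry-false⇐ u i j j<i uj

increment-allFalse : ∀ {n} (u : Vec Bool n) → (∀ i → lookup (increment u) i ≡ false) → ∀ i → lookup u i ≡ true
increment-allFalse (false ∷ u) all0 i with all0 zero
... | ()
increment-allFalse (true ∷ u) all0 zero    = refl
increment-allFalse (true ∷ u) all0 (suc i) = increment-allFalse u (all0 ∘ suc) i

odd : ℕ → Bool
odd zero          = false
odd (suc zero)    = true
odd (suc (suc j)) = odd j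

bitValue : Bool → ℕ
bitValue false = 0
bitValue true  = 1

toBits : (n : ℕ) → ℕ → Vec Bool n
toBits zero    _ = []
toBits (suc n) j = odd j ∷ toBits n ⌊ j /2⌋

odd+half : ∀ j → bitValue (odd j) + (⌊ j /2⌋ + ⌊ j /2⌋) ≡ j
odd+half zero          = refl
odd+half (suc zero)    = refl
odd+half (suc (suc j)) = begin
  b + (suc h + suc h)     ≡⟨ cong (λ x → b + suc x) (+-suc h h) ⟩
  b + suc (suc (h + h))   ≡⟨ +-suc b (suc (h + h)) ⟩
  suc (b + suc (h + h))   ≡⟨ cong suc (+-suc b (h + h)) ⟩
  suc (suc (b + (h + h))) ≡⟨ cong (λ x → suc (suc x)) (odd+half j) ⟩
  suc (suc j)             ∎
  where
  open ≡-Reasoning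
  b = bitValue (odd j)
  h = ⌊ j /2⌋

odd-suc : ∀ j → odd (suc j) ≡ not (odd j)
odd-suc zero          = refl
odd-suc (suc zero)    = refl
odd-suc (suc (suc j)) = odd-suc j

half-suc-odd : ∀ j → odd j ≡ true → ⌊ suc j /2⌋ ≡ suc ⌊ j /2⌋
half-suc-odd (suc zero)    _ = refl
half-suc-odd (suc (suc j)) o = cong suc (half-suc-odd j o)

half-suc-even : ∀ j → odd j ≡ false → ⌊ suc j /2⌋ ≡ ⌊ j /2⌋
half-suc-even zero          _ = refl
half-suc-even (suc (suc j)) e = cong suc (half-suc-even j e)

toBits-suc : ∀ n j → toBits n (suc j) ≡ increment (toBits n j)
toBits-suc zero    j = refl
toBits-suc (suc n) j with odd j in oj
... | true  rewrite odd-suc j | oj | half-suc-odd j oj = cong (false ∷_) (toBits-suc n ⌊ j /2⌋)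
... | false rewrite odd-suc j | oj | half-suc-even j oj = refl

toBits-zero : ∀ n i → lookup (toBits n 0) i ≡ false
toBits-zero (suc n) zero    = refl
toBits-zero (suc n) (suc i) = toBits-zero n i

half-< : ∀ n j → j < 2 ^ suc n → ⌊ j /2⌋ < 2 ^ n
half-< n j j<2^n = ≰⇒> λ 2^n≤h → <⇒≱ j<2^n (begin
  2 ^ suc n                          ≡⟨ cong (2 ^ n +_) (+-identityʳ (2 ^ n)) ⟩
  2 ^ n + 2 ^ n                      ≤⟨ +-mono-≤ 2^n≤h 2^n≤h ⟩
  ⌊ j /2⌋ + ⌊ j /2⌋                  ≤⟨ m≤n+m _ (bitValue (odd j)) ⟩
  bitValue (odd j) + (⌊ j /2⌋ + ⌊ j /2⌋) ≡⟨ odd+half j ⟩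
  j                                  ∎)
  where open ≤-Reasoning

toBits-injective : ∀ n {j j'} → j < 2 ^ n → j' < 2 ^ n → toBits n j ≡ toBits n j' → j ≡ j'
toBits-injective zero    {zero}  {zero}  _ _ _ = refl
toBits-injective zero    {suc j} (s≤s ()) _
toBits-injective zero    {j' = suc j'} _ (s≤s ())
toBits-injective (suc n) {j} {j'} j< j'< eq = begin-equality
  j                                        ≡⟨ sym (odd+half j) ⟩
  bitValue (odd j) + (⌊ j /2⌋ + ⌊ j /2⌋)   ≡⟨ cong₂ (λ b h → bitValue b + (h + h)) (cong head eq) halves ⟩
  bitValue (odd j') + (⌊ j' /2⌋ + ⌊ j' /2⌋) ≡⟨ odd+half j' ⟩
  j'                                       ∎
  where
  open ≤-Reasoning
  halves : ⌊ j /2⌋ ≡ ⌊ j' /2⌋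
  halves = toBits-injective n (half-< n j j<) (half-< n j' j'<) (cong tail eq)

odd-double : ∀ x → odd (x + x) ≡ false
odd-double zero    = refl
odd-double (suc x) rewrite +-suc x x = odd-double x

half-double : ∀ x → ⌊ x + x /2⌋ ≡ x
half-double zero    = refl
half-double (suc x) rewrite +-suc x x = cong suc (half-double x)

toBits-2^n : ∀ n i → lookup (toBits n (2 ^ n)) i ≡ false
toBits-2^n (suc n) zero    rewrite +-identityʳ (2 ^ n) = odd-double (2 ^ n)
toBits-2^n (suc n) (suc i) rewrite +-identityʳ (2 ^ n) | half-double (2 ^ n) = toBits-2^n n i

toBits-last : ∀ n j → suc j ≡ 2 ^ n → ∀ i → lookup (toBits n j) i ≡ true
toBits-last n j sj≡2^n = increment-allFalse (toBits n j) λ i →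
  subst (λ v → lookup v i ≡ false) (trans (cong (toBits n) (sym sj≡2^n)) (toBits-suc n j)) (toBits-2^n n i)

toBits-allTrue : ∀ n j → j < 2 ^ n → (∀ i → lookup (toBits n j) i ≡ true) → suc j ≡ 2 ^ n
toBits-allTrue n j j<2^n all1 with 2 ^ n in 2^n≡ | j<2^n
... | suc last | j< = cong suc (toBits-injective n (subst (j <_) (sym 2^n≡) j<) (subst (last <_) (sym 2^n≡) ≤-refl)
  (vec-ext λ i → trans (all1 i) (sym (toBits-last n last (sym 2^n≡) i))))

-- The shape graph H

specH : ∀ {n} → Fin 1 → Spec n 1
specH _ = record { bitReq = λ _ → optional ; endReq = optional ; nextReq = λ _ → optional }

-- H has a single main node C, all of whose slots but the marks are optional: its
-- "counter nodes" may carry any bit, end and next edges.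
module GraphH (s n : ℕ) where

  open ShapeGraph s n 1 specH public

  H : Graph (suc s)
  H = graph

  C : Node n 1
  C = main zero

  edgeTarget-C : ∀ sl → edgeTarget (slotEdge zero sl) ≡ slotNode sl
  edgeTarget-C (mark b)      = refl
  edgeTarget-C (bit i false) = refl
  edgeTarget-C (bit i true)  = refl
  edgeTarget-C end           = refl
  edgeTarget-C (next zero)   = refl

  module Semantics {G : Graph (suc s)} (G-simple : IsSimple G)
                   {R : Fin (nN G) → Fin (nN H) → Set} (sim : IsSimulation G H R) where

    open Simulated G-simple sim public

    ~-functional : ∀ {y} X X' → y ~ X → y ~ X' → X ≡ X'
    ~-functional (chain a)   (chain b)   r r' = cong chain (chain-functional a b r r')
    ~-functional (chain a)   dead        r r' = contradiction r' (chain-dead-disjoint a r)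
    ~-functional (chain a)   (main _)    r r' = contradiction r' (chain-main-disjoint r)
    ~-functional dead        (chain b)   r r' = contradiction r (chain-dead-disjoint b r')
    ~-functional dead        dead        r r' = refl
    ~-functional dead        (main _)    r r' = contradiction r' (dead-main-disjoint r)
    ~-functional (main _)    (chain b)   r r' = contradiction r (chain-main-disjoint r')
    ~-functional (main _)    dead        r r' = contradiction r (dead-main-disjoint r')
    ~-functional (main zero) (main zero) r r' = refl

    Has : Fin (nN G) → Slot n 1 → Set
    Has y sl = Σ[ e ∈ Out G y ] target G (proj₁ e) ~ slotNode sl

    Bit : Fin n → Fin (nN G) → Set
    Bit i y = Has y (bit i true)

    End : Fin (nN G) → Set
    End y = Has y end

    Next : Fin (nN G) → Fin (nN G) → Set
    Next y z = Σ[ e ∈ Out G y ] target G (proj₁ e) ≡ z × z ~ C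

    target-C : ∀ {y} (r : y ~ C) e {sl} → image r e ≡ slotEdge zero sl → target G (proj₁ e) ~ slotNode sl
    target-C r e {sl} eq = subst (_ ~_) (edgeTarget-C sl) (image-target′ r e eq)

    image-C : ∀ {y} (r : y ~ C) e sl → target G (proj₁ e) ~ slotNode sl → image r e ≡ slotEdge zero sl
    image-C r e sl t~ = let sl' , eq = main-slot r e in
      trans eq (cong (slotEdge zero) (slotNode-injective (~-functional _ _ (target-C r e eq) t~)))

    has? : ∀ {y} → y ~ C → ∀ sl → Dec (Has y sl)
    has? r sl = map′ (λ (e , eq) → e , target-C r e eq) (λ (e , t~) → e , image-C r e sl t~)
                     (image-dec r (slotEdge zero sl))

    next? : ∀ {y} → y ~ C → Dec (∃ (Next y))
    next? r = map′ (λ (e , t~) → target G (proj₁ e) , e , refl , t~) (λ (z , e , eq , z~) → e , subst (_~ C) (sym eq) z~)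
                   (has? r (next zero))

    next-unique : ∀ {y z z'} → y ~ C → Next y z → Next y z' → z ≡ z'
    next-unique r (e , refl , z~) (e' , refl , z'~) = cong (target G)
      (preimage-unique (slotEdge zero (next zero)) r (reqOccur⇒≤1 optional (count∈occur _ r)) e e'
                       (image-C r e (next zero) z~) (image-C r e' (next zero) z'~))

    Represents : Fin (nN G) → Vec Bool n → Set
    Represents y u = ∀ i → Bit i y ⇔ (lookup u i ≡ true)

    bitsOf : ∀ {y} → y ~ C → Vec Bool n
    bitsOf r = tabulate (λ i → does (has? r (bit i true)))

    bitsOf-represents : ∀ {y} (r : y ~ C) → Represents y (bitsOf r)
    bitsOf-represents {y} r i =
      subst (λ b → Bit i y ⇔ (b ≡ true)) (sym (lookup∘tabulate _ i)) (does⇔ (has? r (bit i true)))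
      where
      does⇔ : ∀ {P : Set} (p? : Dec P) → P ⇔ (does p? ≡ true)
      does⇔ (yes p) = mk⇔ (λ _ → refl) (λ _ → p)
      does⇔ (no ¬p) = mk⇔ (λ p → contradiction p ¬p) (λ ())

    represents-functional : ∀ {y u v} → Represents y u → Represents y v → u ≡ v
    represents-functional ru rv = vec-ext λ i → ⇔→≡ (⇔.trans (⇔.sym (ru i)) (rv i))

    Successor : Fin (nN G) → Fin (nN G) → Set
    Successor y z = ∃ λ u → Represents y u × Represents z (increment u)

    data Good : Fin (nN G) → Set where
      last : ∀ {y} → y ~ C → End y → (∀ i → Bit i y) → Good y
      step : ∀ {y z} → y ~ C → Next y z → Successor y z → Good z → Good y

    Bad : Fin (nN G) → Set
    Bad y = ¬ Good y

    good-run : ∀ {y} j → Good y → Represents y (toBits n j) →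
               ∀ t → j + t < 2 ^ n → ∃ λ y' → Represents y' (toBits n (j + t))
    good-run {y} j g rep zero _ = y , subst (Represents y ∘ toBits n) (sym (+-identityʳ j)) rep
    good-run j (last r en all1) rep (suc t) j+t< = contradiction (subst (λ x → x + t < 2 ^ n) 2^n≡ sj+t<) (m+n≮m (2 ^ n) t)
      where
      sj+t< : suc j + t < 2 ^ n
      sj+t< = subst (_< 2 ^ n) (+-suc j t) j+t<
      2^n≡ : suc j ≡ 2 ^ n
      2^n≡ = toBits-allTrue n j (≤-trans (m≤m+n (suc j) t) (<⇒≤ sj+t<)) (λ i → Equivalence.to (rep i) (all1 i))
    good-run j (step {z = z} r nx (u , ru , rz) g) rep (suc t) j+t< =
      let y' , rep' = good-run (suc j) g rep-z t (subst (_< 2 ^ n) (+-suc j t) j+t<)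
      in y' , subst (Represents y' ∘ toBits n) (sym (+-suc j t)) rep'
      where
      rep-z : Represents z (toBits n (suc j))
      rep-z = subst (Represents z) (trans (cong increment (represents-functional {u = u} ru rep)) (sym (toBits-suc n j))) rz

    -- A good node with no bits set starts a run through all 2ⁿ counter values.
    good-zero⇒large : ∀ {y} → Good y → (∀ i → ¬ Bit i y) → 2 ^ n ≤ nN G
    good-zero⇒large {y} g no-bits = injective⇒≤ {f = nodeOf} nodeOf-injective
      where
      rep₀ : Represents y (toBits n 0)
      rep₀ i = mk⇔ (λ b → contradiction b (no-bits i)) (λ eq → contradiction (trans (sym eq) (toBits-zero n i)) λ ())
      run : (t : Fin (2 ^ n)) → ∃ λ y' → Represents y' (toBits n (toℕ t))
      run t = good-run 0 g rep₀ (toℕ t) (toℕ<n t)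
      nodeOf : Fin (2 ^ n) → Fin (nN G)
      nodeOf = proj₁ ∘ run
      nodeOf-injective : ∀ {t t'} → nodeOf t ≡ nodeOf t' → t ≡ t'
      nodeOf-injective {t} {t'} eq = toℕ-injective (toBits-injective n (toℕ<n t) (toℕ<n t')
        (represents-functional (subst (λ y' → Represents y' (toBits n (toℕ t))) eq (proj₂ (run t))) (proj₂ (run t'))))

-- The shape graph K

if-yes : ∀ {P : Set} {A : Set} (p? : Dec P) {x y : A} → P → (if does p? then x else y) ≡ x
if-yes p? p = cong (λ b → if b then _ else _) (dec-true p? p)

if-no : ∀ {P : Set} {A : Set} (p? : Dec P) {x y : A} → ¬ P → (if does p? then x else y) ≡ y
if-no p? ¬p = cong (λ b → if b then _ else _) (dec-false p? ¬p)

if-T : ∀ {A : Set} b {x y : A} → T b → (if b then x else y) ≡ x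
if-T true _ = refl

if-required : ∀ {P : Set} (p? : Dec P) → (if does p? then required else forbidden) ≡ required → P
if-required (yes p) _ = p

required≢forbidden : ∀ {P : Set} (p? : Dec P) → P → (if does p? then required else forbidden) ≢ forbidden
required≢forbidden (yes _) _ ()
required≢forbidden (no ¬p) p = contradiction p ¬p

meets-if : ∀ {P Q : Set} (p? : Dec P) {r r'} → (P → Meets r Q) → (¬ P → Meets r' Q) →
           Meets (if does p? then r else r') Q
meets-if (yes p) f g = f p
meets-if (no ¬p) f g = g ¬p

-- The main nodes of K are indexed by kinds of counter nodes.  A good node is
-- nonzero k (bit k is set) or, behind a defect, successor i c k (bit i is c and bit
-- k is set).  A bad node shows a defect: unfinished k (an end edge, but bit k is
-- unset), badTail (no end edge and only bad successors), noFlip i b k (the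
-- increment carries into bit i, yet bit i of the successor is still b) or
-- spuriousFlip i k' b k (bit k' < i is unset, yet bit i of the successor is not b).
data Kind (n : ℕ) : Set where
  nonzero      : Fin n → Kind n
  unfinished   : Fin n → Kind n
  badTail      : Kind n
  noFlip       : Fin n → Bool → Fin n → Kind n
  spuriousFlip : Fin n → Fin n → Bool → Fin n → Kind n
  successor    : Fin n → Bool → Fin n → Kind n

finiteKind : ∀ {n} → Finite (Kind n)
finiteKind {n} = finite-↔ (F ⊎ᶠ (F ⊎ᶠ (finite⊤ ⊎ᶠ (F×B×F ⊎ᶠ ((F ×ᶠ F×B×F) ⊎ᶠ F×B×F)))))
                          (mk↔ₛ′ to from to-from from-to)
  where
  F = finiteFin n
  F×B×F = F ×ᶠ (finiteBool ×ᶠ F)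
  Code = Fin n ⊎ (Fin n ⊎ (⊤ ⊎ ((Fin n × Bool × Fin n) ⊎ ((Fin n × Fin n × Bool × Fin n) ⊎ (Fin n × Bool × Fin n)))))
  to : Kind n → Code
  to (nonzero k)             = inj₁ k
  to (unfinished k)          = inj₂ (inj₁ k)
  to badTail                 = inj₂ (inj₂ (inj₁ tt))
  to (noFlip i b k)          = inj₂ (inj₂ (inj₂ (inj₁ (i , b , k))))
  to (spuriousFlip i k' b k) = inj₂ (inj₂ (inj₂ (inj₂ (inj₁ (i , k' , b , k)))))
  to (successor i c k)       = inj₂ (inj₂ (inj₂ (inj₂ (inj₂ (i , c , k)))))
  from : Code → Kind n
  from (inj₁ k)                                          = nonzero k
  from (inj₂ (inj₁ k))                                   = unfinished k
  from (inj₂ (inj₂ (inj₁ _)))                            = badTail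
  from (inj₂ (inj₂ (inj₂ (inj₁ (i , b , k)))))           = noFlip i b k
  from (inj₂ (inj₂ (inj₂ (inj₂ (inj₁ (i , k' , b , k)))))) = spuriousFlip i k' b k
  from (inj₂ (inj₂ (inj₂ (inj₂ (inj₂ (i , c , k))))))    = successor i c k
  to-from : ∀ x → to (from x) ≡ x
  to-from (inj₁ k)                                          = refl
  to-from (inj₂ (inj₁ k))                                   = refl
  to-from (inj₂ (inj₂ (inj₁ tt)))                           = refl
  to-from (inj₂ (inj₂ (inj₂ (inj₁ (i , b , k)))))           = refl
  to-from (inj₂ (inj₂ (inj₂ (inj₂ (inj₁ (i , k' , b , k)))))) = refl
  to-from (inj₂ (inj₂ (inj₂ (inj₂ (inj₂ (i , c , k))))))    = refl
  from-to : ∀ κ → from (to κ) ≡ κ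
  from-to (nonzero k)             = refl
  from-to (unfinished k)          = refl
  from-to badTail                 = refl
  from-to (noFlip i b k)          = refl
  from-to (spuriousFlip i k' b k) = refl
  from-to (successor i c k)       = refl

isBad : ∀ {n} → Kind n → Bool
isBad (nonzero _)            = false
isBad (unfinished _)         = true
isBad badTail                = true
isBad (noFlip _ _ _)         = true
isBad (spuriousFlip _ _ _ _) = true
isBad (successor _ _ _)      = false

present : Bool → Req
present true  = required
present false = forbidden

-- successor i c k has bit i equal to c and bit k set; for c = false this needs k ≠ i.
successorValid : ∀ {n} → Fin n → Bool → Fin n → Bool
successorValid i c k = c ∨ not (does (k ≟ i))

module KindSpecs (n : ℕ) where

  Kinds : ℕ
  Kinds = card (finiteKind {n})

  kindOf : Fin Kinds → Kind n
  kindOf = decode finiteKind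

  kindIndex : Kind n → Fin Kinds
  kindIndex = encode finiteKind

  nonzeroSpec : Fin n → Spec n Kinds
  nonzeroSpec k = record
    { bitReq  = λ j → if does (j ≟ k) then required else optional
    ; endReq  = optional
    ; nextReq = λ _ → optional }

  unfinishedSpec : Fin n → Spec n Kinds
  unfinishedSpec k = record
    { bitReq  = λ j → if does (j ≟ k) then forbidden else optional
    ; endReq  = required
    ; nextReq = λ _ → optional }

  badTailSpec : Spec n Kinds
  badTailSpec = record
    { bitReq  = λ _ → optional
    ; endReq  = forbidden
    ; nextReq = λ ν → if isBad (kindOf ν) then optional else forbidden }

  noFlipSpec : Fin n → Bool → Fin n → Spec n Kinds
  noFlipSpec i b k = record
    { bitReq  = λ j → if does (toℕ j <? toℕ i) then required else (if does (j ≟ i) then present b else optional)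
    ; endReq  = forbidden
    ; nextReq = λ ν → if does (ν ≟ kindIndex (successor i b k)) then required else forbidden }

  spuriousFlipSpec : Fin n → Fin n → Bool → Fin n → Spec n Kinds
  spuriousFlipSpec i k' b k = record
    { bitReq  = λ j → if does (j ≟ k') then forbidden else (if does (j ≟ i) then present b else optional)
    ; endReq  = forbidden
    ; nextReq = λ ν → if does (ν ≟ kindIndex (successor i (not b) k)) then required else forbidden }

  successorSpec : Fin n → Bool → Fin n → Spec n Kinds
  successorSpec i c k = record
    { bitReq  = λ j → if does (j ≟ i) then present c else (if does (j ≟ k) then required else optional)
    ; endReq  = optional
    ; nextReq = λ _ → optional }

  -- Ill-formed kinds get the (bad) specification of badTail.
  specKind : Kind n → Spec n Kinds
  specKind (nonzero k)             = nonzeroSpec k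
  specKind (unfinished k)          = unfinishedSpec k
  specKind badTail                 = badTailSpec
  specKind (noFlip i b k)          = noFlipSpec i b k
  specKind (spuriousFlip i k' b k) = if does (toℕ k' <? toℕ i) then spuriousFlipSpec i k' b k else badTailSpec
  specKind (successor i c k)       = if successorValid i c k then successorSpec i c k else badTailSpec

  spec : Fin Kinds → Spec n Kinds
  spec μ = specKind (kindOf μ)

  data BadSpec : Spec n Kinds → Set where
    badTail      : BadSpec badTailSpec
    unfinished   : ∀ k → BadSpec (unfinishedSpec k)
    noFlip       : ∀ i b k → BadSpec (noFlipSpec i b k)
    spuriousFlip : ∀ i k' b k → toℕ k' < toℕ i → BadSpec (spuriousFlipSpec i k' b k)

  isBad⇒BadSpec : ∀ κ → T (isBad κ) → BadSpec (specKind κ)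
  isBad⇒BadSpec (unfinished k)          _ = unfinished k
  isBad⇒BadSpec badTail                 _ = badTail
  isBad⇒BadSpec (noFlip i b k)          _ = noFlip i b k
  isBad⇒BadSpec (spuriousFlip i k' b k) _ = checked (toℕ k' <? toℕ i)
    where
    checked : (k'<i? : Dec (toℕ k' < toℕ i)) →
              BadSpec (if does k'<i? then spuriousFlipSpec i k' b k else badTailSpec)
    checked (yes k'<i) = spuriousFlip i k' b k k'<i
    checked (no _)     = badTail

module GraphK (s n : ℕ) where
  open KindSpecs n public
  open ShapeGraph s n Kinds spec public

  K : Graph (suc s)
  K = graph

-- Graphs in L(H) \ L(K) are large

module Conformance (s n : ℕ) {G : Graph (suc s)} (G-simple : IsSimple G)
                    {R : Fin (nN G) → Fin (nN (GraphH.H s n)) → Set} (sim : IsSimulation G (GraphH.H s n) R) where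

  open GraphH s n
  open Semantics G-simple sim
  open KindSpecs n

  Conforms : Spec n Kinds → Fin (nN G) → Set
  Conforms sp y = (∀ j → Meets (bitReq sp j) (Bit j y)) × Meets (endReq sp) (End y)

  meets-present : ∀ {y} u → Represents y u → ∀ i → Meets (present (lookup u i)) (Bit i y)
  meets-present u rep i with lookup u i in ui
  ... | true  = Equivalence.from (rep i) ui
  ... | false = λ b → contradiction (trans (sym ui) (Equivalence.to (rep i) b)) λ ()

  nonzero-conforms : ∀ {y k} → Bit k y → Conforms (nonzeroSpec k) y
  nonzero-conforms bk = (λ j → meets-if (j ≟ _) (λ { refl → bk }) _) , _

  unfinished-conforms : ∀ {y k} → ¬ Bit k y → End y → Conforms (unfinishedSpec k) y
  unfinished-conforms ¬bk en = (λ j → meets-if (j ≟ _) (λ { refl → ¬bk }) _) , en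

  badTail-conforms : ∀ {y} → ¬ End y → Conforms badTailSpec y
  badTail-conforms ¬en = _ , ¬en

  successor-conforms : ∀ {y u i k} → Represents y u → Bit k y → Conforms (successorSpec i (lookup u i) k) y
  successor-conforms {u = u} {i} rep bk = (λ j → meets-if (j ≟ i) (λ { refl → meets-present u rep i })
                                                      λ _ → meets-if (j ≟ _) (λ { refl → bk }) _) , _

  noFlip-conforms : ∀ {y u i k} → Represents y u → carry u i ≡ true → ¬ End y → Conforms (noFlipSpec i (lookup u i) k) y
  noFlip-conforms {u = u} {i} rep carried ¬en =
    (λ j → meets-if (toℕ j <? toℕ i) (λ j<i → Equivalence.from (rep j) (carry-true⇒ u i carried j j<i))
                    λ _ → meets-if (j ≟ i) (λ { refl → meets-present u rep i }) _) , ¬en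

  spuriousFlip-conforms : ∀ {y u i k' k} → Represents y u → lookup u k' ≡ false → ¬ End y →
                          Conforms (spuriousFlipSpec i k' (lookup u i) k) y
  spuriousFlip-conforms {u = u} {i} {k'} rep uk' ¬en =
    (λ j → meets-if (j ≟ k') (λ { refl → subst (λ b → Meets (present b) _) uk' (meets-present u rep k') })
                    λ _ → meets-if (j ≟ i) (λ { refl → meets-present u rep i }) _) , ¬en

  NextsOK : Kind n → Fin (nN G) → Set
  NextsOK (nonzero _)             y = ⊤
  NextsOK (unfinished _)          y = ⊤
  NextsOK badTail                 y = ∀ z → Next y z → Bad z
  NextsOK (noFlip i b k)          y =
    T (successorValid i b k) × (∀ z → Next y z → Conforms (successorSpec i b k) z) × ∃ (Next y)
  NextsOK (spuriousFlip i k' b k) y = toℕ k' < toℕ i ×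
    T (successorValid i (not b) k) × (∀ z → Next y z → Conforms (successorSpec i (not b) k) z) × ∃ (Next y)
  NextsOK (successor i c k)       y = T (successorValid i c k)

  Classified : Kind n → Fin (nN G) → Set
  Classified κ y = Conforms (specKind κ) y × NextsOK κ y

  Classifiable : Fin (nN G) → Set
  Classifiable z = Σ[ κ ∈ Kind n ] (z ~ C → Classified κ z × (Bad z → T (isBad κ)))

  Classification : Set
  Classification = ∀ z → Classifiable z

  -- A classification turns the simulation into H into one into K: a counter node
  -- goes to the main node of its kind, chain and dead nodes stay where they are.
  module EmbeddingIntoK (classify : Classification) where

    module KG = GraphK s n

    kindAt : Fin (nN G) → Kind n
    kindAt z = proj₁ (classify z)

    classified : ∀ {z} → z ~ C → Classified (kindOf (kindIndex (kindAt z))) z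
    classified {z} z~ = subst (λ κ → Classified κ z) (sym (decode-encode finiteKind (kindAt z))) (proj₁ (proj₂ (classify z) z~))

    bad⇒isBad : ∀ {z} → z ~ C → Bad z → T (isBad (kindOf (kindIndex (kindAt z))))
    bad⇒isBad {z} z~ bad = subst (T ∘ isBad) (sym (decode-encode finiteKind (kindAt z))) (proj₂ (proj₂ (classify z) z~) bad)

    chooseNext : Kind n → Fin (nN G) → Fin Kinds
    chooseNext (noFlip i b k)          _ = kindIndex (successor i b k)
    chooseNext (spuriousFlip i k' b k) _ = kindIndex (successor i (not b) k)
    chooseNext κ                       z = kindIndex (kindAt z)

    successor-classified : ∀ {i c k z} → T (successorValid i c k) → Conforms (successorSpec i c k) z →
                           Classified (kindOf (kindIndex (successor i c k))) z
    successor-classified {i} {c} {k} {z} valid conf =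
      subst (λ κ → Classified κ z) (sym (decode-encode finiteKind (successor i c k)))
            (subst (λ sp → Conforms sp z) (sym (if-T _ valid)) conf , valid)

    chooseNext-ok : ∀ κ {y z} → Classified κ y → Next y z →
                    nextReq (specKind κ) (chooseNext κ z) ≢ forbidden × Classified (kindOf (chooseNext κ z)) z
    chooseNext-ok (nonzero k)    _ (_ , _ , z~) = (λ ()) , classified z~
    chooseNext-ok (unfinished k) _ (_ , _ , z~) = (λ ()) , classified z~
    chooseNext-ok badTail {z = z} (_ , bad-nexts) nx@(_ , _ , z~) = optional≢forbidden (bad⇒isBad z~ (bad-nexts z nx)) , classified z~
      where
      optional≢forbidden : ∀ {b} → T b → (if b then optional else forbidden) ≢ forbidden
      optional≢forbidden {true} _ ()
    chooseNext-ok (noFlip i b k) (_ , valid , conf , _) nx =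
      required≢forbidden (kindIndex (successor i b k) ≟ _) refl , successor-classified valid (conf _ nx)
    chooseNext-ok (spuriousFlip i k' b k) (_ , k'<i , valid , conf , _) nx
      rewrite if-yes (toℕ k' <? toℕ i) {spuriousFlipSpec i k' b k} {badTailSpec} k'<i =
      required≢forbidden (kindIndex (successor i (not b) k) ≟ _) refl , successor-classified valid (conf _ nx)
    chooseNext-ok (successor i c k) (_ , valid) (_ , _ , z~)
      rewrite if-T (successorValid i c k) {successorSpec i c k} {badTailSpec} valid = (λ ()) , classified z~

    required-next : ∀ κ {y} ν → Classified κ y → nextReq (specKind κ) ν ≡ required →
                    Σ[ z ∈ Fin (nN G) ] Next y z × chooseNext κ z ≡ ν
    required-next (nonzero k)    ν _ ()
    required-next (unfinished k) ν _ ()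
    required-next badTail        ν _ eq with isBad (kindOf ν)
    required-next badTail ν _ () | true
    required-next badTail ν _ () | false
    required-next (noFlip i b k) ν (_ , _ , _ , z , nx) eq = z , nx , sym (if-required (ν ≟ kindIndex (successor i b k)) eq)
    required-next (spuriousFlip i k' b k) ν (_ , k'<i , _ , _ , z , nx) eq
      rewrite if-yes (toℕ k' <? toℕ i) {spuriousFlipSpec i k' b k} {badTailSpec} k'<i =
      z , nx , sym (if-required (ν ≟ kindIndex (successor i (not b) k)) eq)
    required-next (successor i c k) ν (_ , valid) eq
      rewrite if-T (successorValid i c k) {successorSpec i c k} {badTailSpec} valid with eq
    ... | ()

    Rel : Fin (nN G) → Node n Kinds → Set
    Rel y (chain a) = y ~ chain a
    Rel y dead      = y ~ dead
    Rel y (main μ)  = y ~ C × Classified (kindOf μ) y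

    RelK : Fin (nN G) → Fin (nN KG.K) → Set
    RelK y x = Rel y (decode KG.nodes x)

    SimAt : Fin (nN G) → Fin (nN KG.K) → Set
    SimAt y x = Σ[ λ' ∈ (Out G y → Out KG.K x) ]
      ((∀ e → (lab G (proj₁ e) ≡ lab KG.K (proj₁ (λ' e))) × RelK (target G (proj₁ e)) (target KG.K (proj₁ (λ' e)))) ×
       (∀ f → preimageSum G KG.K λ' f ⊆I occur KG.K (proj₁ f)))

    RelK-target : ∀ {t} x → Rel t (KG.edgeTarget x) → RelK t (target KG.K (proj₁ (KG.outEdge x)))
    RelK-target {t} x rel =
      subst (Rel t) (sym (decode-encode KG.nodes _)) (subst (Rel t ∘ KG.edgeTarget) (sym (decode-encode KG.edges x)) rel)

    -- Chain and dead nodes have a single out-edge in both shape graphs.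
    singleEdge : ∀ {y} (xH : Edge n 1) (xK : Edge n Kinds) (r : y ~ edgeSource xH) → (∀ e → image r e ≡ xH) →
                 (∀ x → KG.edgeSource x ≡ KG.edgeSource xK → x ≡ xK) → KG.edgeOccur xK ≡ edgeOccur xH →
                 (∀ e → Rel (target G (proj₁ e)) (KG.edgeTarget xK)) → SimAt y (KG.node (KG.edgeSource xK))
    singleEdge {y} xH xK r onlyH onlyK occ≡ targets =
      (λ _ → KG.outEdge xK) , (λ e → label≡ r e , RelK-target xK (targets e)) , counts
      where
      counts : ∀ f → preimageSum G KG.K (λ _ → KG.outEdge xK) f ⊆I occur KG.K (proj₁ f)
      counts f = CK.count∈⇒preimageSum⊆ {occur KG.K (proj₁ f)}
                   (subst (λ x → CK.count ∈I KG.edgeOccur x) (sym f≡xK) count∈)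
        where
        module CK = PreimageCount G KG.K G-simple (λ _ → KG.outEdge xK) f
        f≡xK : decode KG.edges (proj₁ f) ≡ xK
        f≡xK = onlyK _ (KG.outEdge-source f)
        xK≡f : encode KG.edges xK ≡ proj₁ f
        xK≡f = trans (cong (encode KG.edges) (sym f≡xK)) (encode-decode KG.edges (proj₁ f))
        same : CK.count ≡ Count.count r (outEdge xH)
        same = ≤-antisym
          (count-mono G KG.K graph G-simple _ f (edgeMap r) (outEdge xH) λ e (p , _) → image⇒preimage xH r (e , p) (onlyH (e , p)))
          (count-mono G graph KG.K G-simple (edgeMap r) (outEdge xH) _ f λ e (p , _) → p , xK≡f)
        count∈ : CK.count ∈I KG.edgeOccur xK
        count∈ = subst₂ _∈I_ (sym same) (sym occ≡) (count∈occur xH r)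

    module MainCase {y} (μ : Fin Kinds) (r : y ~ C) (cl : Classified (kindOf μ) y) where

      κ : Kind n
      κ = kindOf μ

      sp : Spec n Kinds
      sp = spec μ

      slotOf : Out G y → Slot n 1
      slotOf e = proj₁ (main-slot r e)

      lift : Slot n 1 → Fin (nN G) → Slot n Kinds
      lift (tag t)  _ = tag t
      lift (next _) z = next (chooseNext κ z)

      lower : Slot n Kinds → Slot n 1
      lower (tag t)  = tag t
      lower (next _) = next zero

      lower-lift : ∀ sl z → lower (lift sl z) ≡ sl
      lower-lift (tag t)     _ = refl
      lower-lift (next zero) _ = refl

      slotOf≡ : ∀ e {sl} → image r e ≡ slotEdge zero sl → slotOf e ≡ sl
      slotOf≡ e eq = slotEdge-injective (trans (sym (proj₂ (main-slot r e))) eq)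

      liftedEdge : Out G y → Edge n Kinds
      liftedEdge e = slotEdge μ (lift (slotOf e) (target G (proj₁ e)))

      λM : Out G y → Out KG.K (KG.node (main μ))
      λM e = KG.outEdge (liftedEdge e)

      tag-allowed : ∀ t → Has y (tag t) → slotReq sp (tag t) ≢ forbidden
      tag-allowed (markTag b)      _ ()
      tag-allowed (bitTag i false) _ ()
      tag-allowed (bitTag i true)  h = meets-allowed (bitReq sp i) (proj₁ (proj₁ cl) i) h
      tag-allowed endTag           h = meets-allowed (endReq sp) (proj₂ (proj₁ cl)) h

      required-has : ∀ t → slotReq sp (tag t) ≡ required → Has y (tag t)
      required-has (markTag b) _ = let e , eq = required-preimage (slotEdge zero (mark b)) r refl in e , target-C r e eq
      required-has (bitTag i false) ()
      required-has (bitTag i true) eq = subst (λ q → Meets q (Bit i y)) eq (proj₁ (proj₁ cl) i)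
      required-has endTag          eq = subst (λ q → Meets q (End y)) eq (proj₂ (proj₁ cl))

      target-rel : ∀ e sl → image r e ≡ slotEdge zero sl →
                   Rel (target G (proj₁ e)) (KG.edgeTarget (slotEdge μ (lift sl (target G (proj₁ e)))))
      target-rel e (tag t) eq = subst (Rel _) (sym (reqTarget-allowed _ (tag-allowed t (e , t~)))) t~
        where t~ = target-C r e eq
      target-rel e (next zero) eq = subst (Rel _) (sym (reqTarget-allowed _ (proj₁ ok))) (t~ , proj₂ ok)
        where
        t~ = target-C r e eq
        ok = chooseNext-ok κ cl (e , refl , t~)

      counts : ∀ f → preimageSum G KG.K λM f ⊆I occur KG.K (proj₁ f)
      counts f = CK.count∈⇒preimageSum⊆ {occur KG.K (proj₁ f)} (subst (λ x → CK.count ∈I KG.edgeOccur x) (sym f≡) count∈)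
        where
        module CK = PreimageCount G KG.K G-simple λM f
        f-slot = KG.source-main _ (KG.outEdge-source f)
        sl' = proj₁ f-slot
        f≡ : decode KG.edges (proj₁ f) ≡ slotEdge μ sl'
        f≡ = proj₂ f-slot
        sl'≡f : encode KG.edges (slotEdge μ sl') ≡ proj₁ f
        sl'≡f = trans (cong (encode KG.edges) (sym f≡)) (encode-decode KG.edges (proj₁ f))

        preimage⇒lift : ∀ e → CK.IsPreimage e → Σ[ p ∈ source G e ≡ y ] lift (slotOf (e , p)) (target G e) ≡ sl'
        preimage⇒lift e (p , q) = p , slotEdge-injective
          (trans (sym (decode-encode KG.edges _)) (trans (cong (decode KG.edges) q) f≡))

        lift⇒preimage : ∀ e (p : source G e ≡ y) → lift (slotOf (e , p)) (target G e) ≡ sl' → CK.IsPreimage e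
        lift⇒preimage e p eq = p , trans (cong (encode KG.edges ∘ slotEdge μ) eq) sl'≡f

        count≤1 : CK.count ≤ 1
        count≤1 = ≤-trans
          (count-mono G KG.K graph G-simple λM f (edgeMap r) (outEdge (slotEdge zero (lower sl'))) λ e pe →
            let p , eq = preimage⇒lift e pe in
            image⇒preimage _ r (e , p) (trans (proj₂ (main-slot r (e , p)))
              (cong (slotEdge zero) (trans (sym (lower-lift _ (target G e))) (cong lower eq)))))
          (reqOccur⇒≤1 (slotReq (specH zero) (lower sl')) (count∈occur (slotEdge zero (lower sl')) r))

        required⇒pos : ∀ sl → sl ≡ sl' → slotReq sp sl ≡ required → 1 ≤ CK.count
        required⇒pos (tag t) sl≡ req =
          let (e , p) , t~ = required-has t req in
          CK.count-pos e (lift⇒preimage e p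
            (trans (cong (λ sl → lift sl (target G e)) (slotOf≡ (e , p) (image-C r (e , p) (tag t) t~))) sl≡))
        required⇒pos (next ν) sl≡ req =
          let z , ((e , p) , t≡z , z~) , chosen = required-next κ ν cl req in
          CK.count-pos e (lift⇒preimage e p
            (trans (cong (λ sl → lift sl (target G e)) (slotOf≡ (e , p) (image-C r (e , p) (next zero) (subst (_~ C) (sym t≡z) z~))))
                   (trans (cong next (trans (cong (chooseNext κ) t≡z) chosen)) sl≡)))

        count∈ : CK.count ∈I reqOccur (slotReq sp sl')
        count∈ = ≤1⇒reqOccur _ count≤1 (required⇒pos sl' refl)

      simulates : SimAt y (KG.node (main μ))
      simulates = λM , (λ e → label≡ r e , RelK-target (liftedEdge e) (target-rel e (slotOf e) (proj₂ (main-slot r e)))) , counts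

    simAt : ∀ y X → Rel y X → SimAt y (KG.node X)
    simAt y (chain zero) r =
      (λ e → contradiction e (chain₀-noOut r)) , (λ e → contradiction e (chain₀-noOut r)) ,
      (λ f → contradiction (KG.outEdge-source f) (KG.source-chain₀ _))
    simAt y (chain (suc a)) r =
      singleEdge (chainEdge a) (chainEdge a) r (chainSuc-image r) (λ x → KG.source-chainSuc x) refl (chainSuc-target r)
    simAt y dead r = singleEdge deadLoop deadLoop r (dead-image r) (λ x → KG.source-dead x) refl (dead-target r)
    simAt y (main μ) (r , cl) = MainCase.simulates μ r cl

    simulation : IsSimulation G KG.K RelK
    simulation y x rel = subst (SimAt y) (encode-decode KG.nodes x) (simAt y (decode KG.nodes x) rel)

    relatedK : ∀ y X → y ~ X → ∃ (RelK y)
    relatedK y (chain a)   r = KG.node (chain a) , subst (Rel y) (sym (decode-encode KG.nodes (chain a))) r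
    relatedK y dead        r = KG.node dead , subst (Rel y) (sym (decode-encode KG.nodes dead)) r
    relatedK y (main zero) r = KG.node X , subst (Rel y) (sym (decode-encode KG.nodes X)) (r , classified r)
      where X = main (kindIndex (kindAt y))

    embedding : (∀ y → ∃ (R y)) → G ≼ KG.K
    embedding total = RelK , simulation , λ y →
      let h , yRh = total y in relatedK y (decode nodes h) ⟨ subst (R y) (sym (encode-decode nodes h)) yRh ⟩

¬¬-Π : ∀ N {A : Fin N → Set} → (∀ i → ¬ ¬ A i) → ¬ ¬ (∀ i → A i)
¬¬-Π zero    _ = λ ¬all → ¬all λ ()
¬¬-Π (suc N) {A} h = do
  a₀   ← h zero
  rest ← ¬¬-Π N (h ∘ suc)
  return (∀-cons {P = A} a₀ rest)
  where open RawMonad (¬¬-Monad {0ℓ})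

module Classify (s n : ℕ) {G : Graph (suc s)} (G-simple : IsSimple G)
                {R : Fin (nN G) → Fin (nN (GraphH.H s n)) → Set} (sim : IsSimulation G (GraphH.H s n) R)
                (small : nN G < 2 ^ n) where

  open GraphH s n
  open Semantics G-simple sim
  open KindSpecs n
  open Conformance s n G-simple sim
  open RawMonad (¬¬-Monad {0ℓ}) using (return; _>>=_)

  nonzero-bit : ∀ {z} → z ~ C → Good z → ∃ λ k → Bit k z
  nonzero-bit r g with any? (λ i → has? r (bit i true))
  ... | yes found = found
  ... | no ¬bit = contradiction (good-zero⇒large g λ i b → ¬bit (i , b)) (<⇒≱ small)

  good-classified : ∀ {z} → z ~ C → Good z → Classifiable z
  good-classified r g = let k , bk = nonzero-bit r g in
    nonzero k , λ _ → (nonzero-conforms bk , tt) , λ bad → contradiction g bad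

  ended-classified : ∀ {z} → z ~ C → Bad z → End z → Classifiable z
  ended-classified r bad en with any? (λ i → ¬? (has? r (bit i true)))
  ... | yes (k , ¬bk) = unfinished k , λ _ → (unfinished-conforms ¬bk en , tt) , _
  ... | no all-bits   = contradiction (last r en λ i → decidable-stable (has? r (bit i true)) λ ¬bi → all-bits (i , ¬bi)) bad

  badTail-classified : ∀ {z} → ¬ End z → (∀ w → Next z w → Bad w) → Classifiable z
  badTail-classified ¬en bad-nexts = badTail , λ _ → (badTail-conforms ¬en , bad-nexts) , _

  -- A bad node without end edge whose next node w is good: since w is nonzero and
  -- the bits of w are not the increment of those of z, some bit i of w is wrong.
  module Defect {z w} (r : z ~ C) (bad : Bad z) (¬en : ¬ End z) (nx : Next z w) (gw : Good w) where
    w~ : w ~ C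
    w~ = proj₂ (proj₂ nx)

    u uw : Vec Bool n
    u  = bitsOf r
    uw = bitsOf w~

    ru : Represents z u
    ru = bitsOf-represents r

    ruw : Represents w uw
    ruw = bitsOf-represents w~

    k : Fin n
    k = proj₁ (nonzero-bit w~ gw)

    bk : Bit k w
    bk = proj₂ (nonzero-bit w~ gw)

    valid : ∀ i → T (successorValid i (lookup uw i) k)
    valid i with lookup uw i in uwi
    ... | true  = tt
    ... | false = subst (λ b → T (not b)) (sym (dec-false (k ≟ i) k≢i)) tt
      where
      k≢i : k ≢ i
      k≢i refl = contradiction (trans (sym uwi) (Equivalence.to (ruw k) bk)) λ ()

    nexts-conform : ∀ i → ∀ z' → Next z z' → Conforms (successorSpec i (lookup uw i) k) z'
    nexts-conform i z' nx' =
      subst (Conforms (successorSpec i (lookup uw i) k)) (next-unique r nx nx') (successor-conforms {u = uw} ruw bk)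

    wrong-bit : ∀ i → lookup uw i ≢ lookup (increment u) i → Classifiable z
    wrong-bit i wrong with carry u i in carried
    ... | true  = noFlip i (lookup u i) k , λ _ →
        (noFlip-conforms {u = u} {k = k} ru carried ¬en ,
         subst (λ b → T (successorValid i b k)) kept (valid i) ,
         subst (λ b → ∀ z' → Next z z' → Conforms (successorSpec i b k) z') kept (nexts-conform i) , w , nx) , _
      where
      kept : lookup uw i ≡ lookup u i
      kept = trans (¬-not (subst (lookup uw i ≢_) (increment-carry u i carried) wrong)) (not-involutive _)
    ... | false = spuriousFlip i k' (lookup u i) k , λ _ →
        (subst (λ sp → Conforms sp z) (sym (if-yes (toℕ k' <? toℕ i) k'<i)) (spuriousFlip-conforms {u = u} {k = k} ru uk' ¬en) ,
         k'<i , subst (λ b → T (successorValid i b k)) flipped (valid i) ,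
         subst (λ b → ∀ z' → Next z z' → Conforms (successorSpec i b k) z') flipped (nexts-conform i) , w , nx) , _
      where
      flipped : lookup uw i ≡ not (lookup u i)
      flipped = ¬-not (subst (lookup uw i ≢_) (increment-noCarry u i carried) wrong)
      k' = proj₁ (carry-false⇒ u i carried)
      k'<i = proj₁ (proj₂ (carry-false⇒ u i carried))
      uk' = proj₂ (proj₂ (carry-false⇒ u i carried))

    classified : Classifiable z
    classified with any? (λ i → ¬? (lookup uw i ≟ᵇ lookup (increment u) i))
    ... | yes (i , wrong) = wrong-bit i wrong
    ... | no all-right = contradiction (step r nx (u , ru , subst (Represents w) uw≡ ruw) gw) bad
      where
      uw≡ : uw ≡ increment u
      uw≡ = vec-ext λ i → decidable-stable (lookup uw i ≟ᵇ lookup (increment u) i) λ wrong → all-right (i , wrong)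

  bad-classified : ∀ {z} → z ~ C → Bad z → ¬ ¬ Classifiable z
  bad-classified r bad with has? r end | next? r
  ... | yes en  | _            = return (ended-classified r bad en)
  ... | no ¬en  | no ¬nx       = return (badTail-classified ¬en λ w nx → contradiction (w , nx) ¬nx)
  ... | no ¬en  | yes (w , nx) = ¬¬-excluded-middle >>= λ where
    (yes gw) → return (Defect.classified r bad ¬en nx gw)
    (no bw)  → return (badTail-classified ¬en λ w' nx' → subst Bad (next-unique r nx nx') bw)

  classify : ∀ z → ¬ ¬ Classifiable z
  classify z = ¬¬-excluded-middle >>= λ where
    (no ¬r) → return (badTail , λ r → contradiction r ¬r)
    (yes r) → ¬¬-excluded-middle >>= λ where
      (yes g)  → return (good-classified r g)
      (no bad) → bad-classified r bad

-- If G had fewer than 2ⁿ nodes, all its nodes could be classified, so G would embed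
-- into K.  The classification uses excluded middle, which is harmless here since the
-- conclusion is decidable.
∉K⇒large : ∀ s n (G : Graph (suc s)) → G ∈L GraphH.H s n → ¬ G ∈L GraphK.K s n → 2 ^ n ≤ size G
∉K⇒large s n G (G-simple , R , sim , total) G∉K = decidable-stable (2 ^ n ≤? size G) λ ¬large →
  ¬¬-Π (nN G) (Classify.classify s n G-simple sim (≤-<-trans (m≤m+n (nN G) (nE G)) (≰⇒> ¬large))) λ classification →
  G∉K (G-simple , Conformance.EmbeddingIntoK.embedding s n G-simple sim classification total)

-- The counter graph

-- The witness: counter nodes 0, …, 2ⁿ - 1, node j carrying the bits of j and a
-- last edge to node j + 1, or to the end tag for j = 2ⁿ - 1, together with the chain.
module Witness (s n : ℕ) where

  data WNode : Set where
    chainW  : Fin (ChainLength n) → WNode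
    counter : Fin (2 ^ n) → WNode

  data WSlot : Set where
    markOut : Bool → WSlot
    bitOut  : Fin n → WSlot
    lastOut : WSlot

  data WEdge : Set where
    chainEdgeW  : Fin (pred (ChainLength n)) → WEdge
    counterEdge : Fin (2 ^ n) → WSlot → WEdge

  nodesW : Finite WNode
  nodesW = finite-↔ (finiteFin (ChainLength n) ⊎ᶠ finiteFin (2 ^ n)) (mk↔ₛ′ to from to-from from-to)
    where
    to : WNode → Fin (ChainLength n) ⊎ Fin (2 ^ n)
    to (chainW a)  = inj₁ a
    to (counter j) = inj₂ j
    from : Fin (ChainLength n) ⊎ Fin (2 ^ n) → WNode
    from (inj₁ a) = chainW a
    from (inj₂ j) = counter j
    to-from : ∀ x → to (from x) ≡ x
    to-from (inj₁ a) = refl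
    to-from (inj₂ j) = refl
    from-to : ∀ x → from (to x) ≡ x
    from-to (chainW a)  = refl
    from-to (counter j) = refl

  slotsW : Finite WSlot
  slotsW = finite-↔ (finiteBool ⊎ᶠ (finiteFin n ⊎ᶠ finite⊤)) (mk↔ₛ′ to from to-from from-to)
    where
    to : WSlot → Bool ⊎ (Fin n ⊎ ⊤)
    to (markOut b) = inj₁ b
    to (bitOut i)  = inj₂ (inj₁ i)
    to lastOut     = inj₂ (inj₂ tt)
    from : Bool ⊎ (Fin n ⊎ ⊤) → WSlot
    from (inj₁ b)        = markOut b
    from (inj₂ (inj₁ i)) = bitOut i
    from (inj₂ (inj₂ _)) = lastOut
    to-from : ∀ x → to (from x) ≡ x
    to-from (inj₁ b)         = refl
    to-from (inj₂ (inj₁ i))  = refl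
    to-from (inj₂ (inj₂ tt)) = refl
    from-to : ∀ x → from (to x) ≡ x
    from-to (markOut b) = refl
    from-to (bitOut i)  = refl
    from-to lastOut     = refl

  edgesW : Finite WEdge
  edgesW = finite-↔ (finiteFin (pred (ChainLength n)) ⊎ᶠ (finiteFin (2 ^ n) ×ᶠ slotsW)) (mk↔ₛ′ to from to-from from-to)
    where
    to : WEdge → Fin (pred (ChainLength n)) ⊎ (Fin (2 ^ n) × WSlot)
    to (chainEdgeW a)    = inj₁ a
    to (counterEdge j s) = inj₂ (j , s)
    from : Fin (pred (ChainLength n)) ⊎ (Fin (2 ^ n) × WSlot) → WEdge
    from (inj₁ a)       = chainEdgeW a
    from (inj₂ (j , s)) = counterEdge j s
    to-from : ∀ x → to (from x) ≡ x
    to-from (inj₁ a)       = refl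
    to-from (inj₂ (j , s)) = refl
    from-to : ∀ x → from (to x) ≡ x
    from-to (chainEdgeW a)    = refl
    from-to (counterEdge j s) = refl

  tagW : Tag n → WNode
  tagW t = chainW (tagIndex t)

  counterBits : Fin (2 ^ n) → Vec Bool n
  counterBits j = toBits n (toℕ j)

  IsLast : Fin (2 ^ n) → Set
  IsLast j = ¬ suc (toℕ j) < 2 ^ n

  data LastEdge (j : Fin (2 ^ n)) : Slot n 1 → WNode → Set where
    toSuccessor : (lt : suc (toℕ j) < 2 ^ n) → LastEdge j (next zero) (counter (fromℕ< lt))
    toEnd       : IsLast j → LastEdge j end (tagW endTag)

  lastEdge : ∀ j → Dec (suc (toℕ j) < 2 ^ n) → Σ[ sl ∈ Slot n 1 ] Σ[ x ∈ WNode ] LastEdge j sl x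
  lastEdge j (yes lt) = next zero , counter (fromℕ< lt) , toSuccessor lt
  lastEdge j (no ¬lt) = end , tagW endTag , toEnd ¬lt

  lastOf : ∀ j → Σ[ sl ∈ Slot n 1 ] Σ[ x ∈ WNode ] LastEdge j sl x
  lastOf j = lastEdge j (suc (toℕ j) <? 2 ^ n)

  hSlot : Fin (2 ^ n) → WSlot → Slot n 1
  hSlot j (markOut b) = mark b
  hSlot j (bitOut i)  = bit i (lookup (counterBits j) i)
  hSlot j lastOut     = proj₁ (lastOf j)

  counterTarget : Fin (2 ^ n) → WSlot → WNode
  counterTarget j (markOut b) = tagW (markTag b)
  counterTarget j (bitOut i)  = tagW (bitTag i (lookup (counterBits j) i))
  counterTarget j lastOut     = proj₁ (proj₂ (lastOf j))

  wSource : WEdge → WNode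
  wSource (chainEdgeW a)    = chainW (suc a)
  wSource (counterEdge j _) = counter j

  wTarget : WEdge → WNode
  wTarget (chainEdgeW a)    = chainW (inject₁ a)
  wTarget (counterEdge j s) = counterTarget j s

  Gw : Graph (suc s)
  Gw = record
    { nN     = card nodesW
    ; nE     = card edgesW
    ; source = encode nodesW ∘ wSource ∘ decode edgesW
    ; target = encode nodesW ∘ wTarget ∘ decode edgesW
    ; lab    = λ _ → zero
    ; occur  = λ _ → I11 }

  wnode : WNode → Fin (nN Gw)
  wnode = encode nodesW

  hSlot-last : ∀ j s → s ≢ lastOut → hSlot j lastOut ≢ hSlot j s
  hSlot-last j s s≢last with lastOf j
  hSlot-last j (markOut b) _ | _ , _ , toSuccessor _ = λ ()
  hSlot-last j (bitOut i)  _ | _ , _ , toSuccessor _ = λ ()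
  hSlot-last j (markOut b) _ | _ , _ , toEnd _ = λ ()
  hSlot-last j (bitOut i)  _ | _ , _ , toEnd _ = λ ()
  hSlot-last j lastOut s≢last | _ = contradiction refl s≢last

  hSlot-injective : ∀ j {s s'} → hSlot j s ≡ hSlot j s' → s ≡ s'
  hSlot-injective j {markOut b} {markOut .b} refl = refl
  hSlot-injective j {bitOut i}  {bitOut .i}  refl = refl
  hSlot-injective j {lastOut}   {lastOut}    _    = refl
  hSlot-injective j {markOut b} {lastOut}    eq   = contradiction (sym eq) (hSlot-last j (markOut b) λ ())
  hSlot-injective j {bitOut i}  {lastOut}    eq   = contradiction (sym eq) (hSlot-last j (bitOut i) λ ())
  hSlot-injective j {lastOut}   {markOut b}  eq   = contradiction eq (hSlot-last j (markOut b) λ ())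
  hSlot-injective j {lastOut}   {bitOut i}   eq   = contradiction eq (hSlot-last j (bitOut i) λ ())

  hSlot-bit : ∀ j s {i v} → hSlot j s ≡ bit i v → lookup (counterBits j) i ≡ v
  hSlot-bit j (bitOut i) refl = refl
  hSlot-bit j lastOut eq with lastOf j
  hSlot-bit j lastOut () | _ , _ , toSuccessor _
  hSlot-bit j lastOut () | _ , _ , toEnd _

  hSlot-end : ∀ j s → hSlot j s ≡ end → IsLast j
  hSlot-end j lastOut eq with lastOf j
  hSlot-end j lastOut () | _ , _ , toSuccessor _
  hSlot-end j lastOut _  | _ , _ , toEnd last = last

  hSlot-next : ∀ j s → hSlot j s ≡ next zero → Σ[ lt ∈ suc (toℕ j) < 2 ^ n ] counterTarget j s ≡ counter (fromℕ< lt)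
  hSlot-next j lastOut eq with lastOf j
  hSlot-next j lastOut _  | _ , _ , toSuccessor lt = lt , refl
  hSlot-next j lastOut () | _ , _ , toEnd _

  last-end : ∀ j → IsLast j → hSlot j lastOut ≡ end
  last-end j last with lastOf j
  ... | _ , _ , toSuccessor lt = contradiction lt last
  ... | _ , _ , toEnd _        = refl

  last-next : ∀ j (lt : suc (toℕ j) < 2 ^ n) → hSlot j lastOut ≡ next zero × counterTarget j lastOut ≡ counter (fromℕ< lt)
  last-next j lt with lastOf j
  ... | _ , _ , toSuccessor lt′ = refl , cong counter (fromℕ<-cong _ _ refl lt′ lt)
  ... | _ , _ , toEnd last      = contradiction lt last

  toH : WNode → Node n 1
  toH (chainW a)  = chain a
  toH (counter _) = main zero

  toH-target : ∀ j s → toH (counterTarget j s) ≡ slotNode (hSlot j s)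
  toH-target j (markOut b) = refl
  toH-target j (bitOut i)  = refl
  toH-target j lastOut with lastOf j
  ... | _ , _ , toSuccessor _ = refl
  ... | _ , _ , toEnd _       = refl

  counterTarget-injective : ∀ j {s s'} → counterTarget j s ≡ counterTarget j s' → s ≡ s'
  counterTarget-injective j {s} {s'} eq =
    hSlot-injective j (slotNode-injective (trans (sym (toH-target j s)) (trans (cong toH eq) (toH-target j s'))))

  wEdge-injective : ∀ {x x'} → wSource x ≡ wSource x' → wTarget x ≡ wTarget x' → x ≡ x'
  wEdge-injective {chainEdgeW a}    {chainEdgeW .a}    refl _ = refl
  wEdge-injective {counterEdge j s} {counterEdge .j s'} refl t≡ = cong (counterEdge j) (counterTarget-injective j t≡)

  Gw-simple : IsSimple Gw
  Gw-simple = (λ _ → refl , refl) , λ e e' s≡ t≡ _ →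
    trans (sym (encode-decode edgesW e))
          (trans (cong (encode edgesW) (wEdge-injective {decode edgesW e} {decode edgesW e'}
                                                         (encode-injective nodesW s≡) (encode-injective nodesW t≡)))
                 (encode-decode edgesW e'))

  outW : (x : WEdge) → Out Gw (wnode (wSource x))
  outW x = encode edgesW x , cong (wnode ∘ wSource) (decode-encode edgesW x)

  outW-source : ∀ {Y} (e : Out Gw (wnode Y)) → wSource (decode edgesW (proj₁ e)) ≡ Y
  outW-source e = encode-injective nodesW (proj₂ e)

  outW-unique : ∀ {Y} (e e' : Out Gw (wnode Y)) → decode edgesW (proj₁ e) ≡ decode edgesW (proj₁ e') →
                proj₁ e ≡ proj₁ e'
  outW-unique e e' eq =
    trans (sym (encode-decode edgesW (proj₁ e))) (trans (cong (encode edgesW) eq) (encode-decode edgesW (proj₁ e')))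

  source-chainW₀ : ∀ x → wSource x ≢ chainW zero
  source-chainW₀ (chainEdgeW _) ()
  source-chainW₀ (counterEdge _ _) ()

  source-chainWSuc : ∀ x {a} → wSource x ≡ chainW (suc a) → x ≡ chainEdgeW a
  source-chainWSuc (chainEdgeW a) refl = refl

  source-counter : ∀ x {j} → wSource x ≡ counter j → ∃ λ s → x ≡ counterEdge j s
  source-counter (counterEdge j s) refl = s , refl

  module IntoH where
    open GraphH s n

    RelH : Fin (nN Gw) → Fin (nN H) → Set
    RelH y h = Σ[ Y ∈ WNode ] y ≡ wnode Y × h ≡ node (toH Y)

    SimAt : Fin (nN Gw) → Fin (nN H) → Set
    SimAt y h = Σ[ λ' ∈ (Out Gw y → Out H h) ]
      ((∀ e → (lab Gw (proj₁ e) ≡ lab H (proj₁ (λ' e))) × RelH (target Gw (proj₁ e)) (target H (proj₁ (λ' e)))) ×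
       (∀ f → preimageSum Gw H λ' f ⊆I occur H (proj₁ f)))

    target-rel : ∀ e x → toH (wTarget (decode edgesW e)) ≡ edgeTarget x → RelH (target Gw e) (target H (encode edges x))
    target-rel e x eq = wTarget (decode edgesW e) , refl , cong node (trans (cong edgeTarget (decode-encode edges x)) (sym eq))

    module CounterCase (j : Fin (2 ^ n)) where

      slotOfW : Out Gw (wnode (counter j)) → WSlot
      slotOfW e = proj₁ (source-counter _ (outW-source e))

      slotOfW≡ : ∀ e → decode edgesW (proj₁ e) ≡ counterEdge j (slotOfW e)
      slotOfW≡ e = proj₂ (source-counter _ (outW-source e))

      λC : Out Gw (wnode (counter j)) → Out H (node C)
      λC e = outEdge (slotEdge zero (hSlot j (slotOfW e)))

      targets : ∀ e → toH (wTarget (decode edgesW (proj₁ e))) ≡ edgeTarget (slotEdge zero (hSlot j (slotOfW e)))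
      targets e =
        trans (cong (toH ∘ wTarget) (slotOfW≡ e)) (trans (toH-target j (slotOfW e)) (sym (edgeTarget-C (hSlot j (slotOfW e)))))

      λC-injective : ∀ e e' → proj₁ (λC e) ≡ proj₁ (λC e') → proj₁ e ≡ proj₁ e'
      λC-injective e e' eq = outW-unique {counter j} e e' (trans (slotOfW≡ e)
        (trans (cong (counterEdge j) (hSlot-injective j (slotEdge-injective {μ = zero} {zero} (encode-injective edges eq)))) (sym (slotOfW≡ e'))))

      mark-preimage : ∀ b → Σ[ e ∈ Out Gw (wnode (counter j)) ] proj₁ (λC e) ≡ encode edges (slotEdge zero (mark b))
      mark-preimage b = e , cong (λ s → encode edges (slotEdge zero (hSlot j s))) markOut≡
        where
        e = outW (counterEdge j (markOut b))
        counterEdge-injective : ∀ {s s'} → counterEdge j s ≡ counterEdge j s' → s ≡ s'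
        counterEdge-injective refl = refl
        markOut≡ : slotOfW e ≡ markOut b
        markOut≡ = counterEdge-injective (trans (sym (slotOfW≡ e)) (decode-encode edgesW _))

      counts : ∀ f → preimageSum Gw H λC f ⊆I occur H (proj₁ f)
      counts f = C.count∈⇒preimageSum⊆ {occur H (proj₁ f)} (subst (λ x → C.count ∈I edgeOccur x) (sym f≡)
                   (≤1⇒reqOccur (slotReq (specH zero) (proj₁ f-slot)) (C.count≤1-injective λC-injective)
                                (required⇒pos (proj₁ f-slot) f≡)))
        where
        module C = PreimageCount Gw H Gw-simple λC f
        f-slot = source-main _ (outEdge-source f)
        f≡ : decode edges (proj₁ f) ≡ slotEdge zero (proj₁ f-slot)
        f≡ = proj₂ f-slot
        required⇒pos : ∀ sl → decode edges (proj₁ f) ≡ slotEdge zero sl → slotReq (specH zero) sl ≡ required → 1 ≤ C.count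
        required⇒pos (mark b) f≡′ _ = let (e , p) , eq = mark-preimage b in
          C.count-pos e (p , trans eq (trans (cong (encode edges) (sym f≡′)) (encode-decode edges (proj₁ f))))
        required⇒pos (bit i false) _ ()
        required⇒pos (bit i true)  _ ()
        required⇒pos end           _ ()
        required⇒pos (next _)      _ ()

      simulates : SimAt (wnode (counter j)) (node C)
      simulates = λC , (λ e → refl , target-rel (proj₁ e) (slotEdge zero (hSlot j (slotOfW e))) (targets e)) , counts

    simAt : ∀ Y → SimAt (wnode Y) (node (toH Y))
    simAt (chainW zero) =
      (λ e → contradiction (outW-source e) (source-chainW₀ _)) , (λ e → contradiction (outW-source e) (source-chainW₀ _)) ,
      (λ f → contradiction (outEdge-source f) (source-chain₀ _))
    simAt (chainW (suc a)) = (λ _ → outEdge (chainEdge a)) , (λ e → refl , target-rel (proj₁ e) (chainEdge a) (tgt e)) , cnt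
      where
      only : ∀ (e : Out Gw (wnode (chainW (suc a)))) → decode edgesW (proj₁ e) ≡ chainEdgeW a
      only e = source-chainWSuc _ (outW-source e)
      tgt : ∀ e → toH (wTarget (decode edgesW (proj₁ e))) ≡ chain (inject₁ a)
      tgt e = cong (toH ∘ wTarget) (only e)
      cnt : ∀ f → preimageSum Gw H (λ _ → outEdge (chainEdge a)) f ⊆I occur H (proj₁ f)
      cnt f = C.count∈⇒preimageSum⊆ {occur H (proj₁ f)} (subst (λ x → C.count ∈I edgeOccur x) (sym f≡)
                (≤1⇒reqOccur required
                  (C.count≤1-injective λ e e' _ → outW-unique {chainW (suc a)} e e' (trans (only e) (sym (only e'))))
                  λ _ → C.count-pos (proj₁ (outW (chainEdgeW a)))
                          (proj₂ (outW (chainEdgeW a)) , trans (cong (encode edges) (sym f≡)) (encode-decode edges (proj₁ f)))))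
        where
        module C = PreimageCount Gw H Gw-simple (λ _ → outEdge (chainEdge a)) f
        f≡ : decode edges (proj₁ f) ≡ chainEdge a
        f≡ = source-chainSuc _ (outEdge-source f)
    simAt (counter j) = CounterCase.simulates j

    Gw∈H : Gw ∈L H
    Gw∈H = Gw-simple , RelH , simulation , λ y → node (toH (decode nodesW y)) , decode nodesW y , sym (encode-decode nodesW y) , refl
      where
      simulation : IsSimulation Gw H RelH
      simulation y h (Y , refl , refl) = simAt Y

module NotInK (s n : ℕ) where
  open Witness s n
  open GraphK s n

  counter-twoOut : ∀ j → proj₁ (outW (counterEdge j (markOut false))) ≢ proj₁ (outW (counterEdge j (markOut true)))
  counter-twoOut j eq with encode-injective edgesW {counterEdge j (markOut false)} {counterEdge j (markOut true)} eq
  ... | ()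

  chainW-out-unique : ∀ a (e e' : Out Gw (wnode (chainW a))) → proj₁ e ≡ proj₁ e'
  chainW-out-unique zero    e e' = contradiction (outW-source e) (source-chainW₀ _)
  chainW-out-unique (suc a) e e' =
    outW-unique {chainW (suc a)} e e' (trans (source-chainWSuc _ (outW-source e)) (sym (source-chainWSuc _ (outW-source e'))))

  outW-target : ∀ x → target Gw (proj₁ (outW x)) ≡ wnode (wTarget x)
  outW-target x = cong (wnode ∘ wTarget) (decode-encode edgesW x)

  module _ {R : Fin (nN Gw) → Fin (nN K) → Set} (sim : IsSimulation Gw K R) where
    open Simulated Gw-simple sim

    _≈_ : WNode → Node n Kinds → Set
    Y ≈ X = wnode Y ~ X

    along : ∀ x {X} → target Gw (proj₁ (outW x)) ~ X → wTarget x ≈ X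
    along x = subst (_~ _) (outW-target x)

    counter-notChain : ∀ {j a} → ¬ counter j ≈ chain a
    counter-notChain {j} {zero}  r = chain₀-noOut r (outW (counterEdge j (markOut false)))
    counter-notChain {j} {suc a} r =
      counter-twoOut j (chainSuc-unique r (outW (counterEdge j (markOut false))) (outW (counterEdge j (markOut true))))

    counter-notDead : ∀ {j} → ¬ counter j ≈ dead
    counter-notDead {j} r = counter-twoOut j (dead-unique r (outW (counterEdge j (markOut false))) (outW (counterEdge j (markOut true))))

    chain-rigid : ∀ a X → chainW a ≈ X → X ≡ chain a
    chain-rigid a X = go a X refl
      where
      go : ∀ {k} a X → toℕ a ≡ k → chainW a ≈ X → X ≡ chain a
      go a (main μ) _ r = contradiction (chainW-out-unique a) (main-notSingleOut r)
      go zero    dead _ r = contradiction (dead-out r) (λ e → source-chainW₀ _ (outW-source e))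
      go {suc k} (suc a) dead eq r with go (inject₁ a) dead (trans (toℕ-inject₁ a) (suc-injectiveℕ eq))
                                         (along (chainEdgeW a) (dead-target r (outW (chainEdgeW a))))
      ... | ()
      go zero    (chain zero)    _ r = refl
      go zero    (chain (suc b)) _ r = contradiction (outW-source (chainSuc-out r)) (source-chainW₀ _)
      go (suc a) (chain zero)    _ r = contradiction (outW (chainEdgeW a)) (chain₀-noOut r)
      go {suc k} (suc a) (chain (suc b)) eq r with go (inject₁ a) (chain (inject₁ b)) (trans (toℕ-inject₁ a) (suc-injectiveℕ eq))
                                                   (along (chainEdgeW a) (chainSuc-target r (outW (chainEdgeW a))))
      ... | eq′ = cong (chain ∘ suc) (inject₁-injective (chain-injective eq′))

    not-dead : ∀ Y → ¬ Y ≈ dead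
    not-dead (chainW a)  r = contradiction (chain-rigid a dead r) λ ()
    not-dead (counter j) r = counter-notDead r

    tag-rigid : ∀ Y t → Y ≈ tagNode t → toH Y ≡ tagNode t
    tag-rigid (chainW a)  t r = cong chain (sym (chain-injective (chain-rigid a _ r)))
    tag-rigid (counter j) t r = contradiction r counter-notChain

    main-rigid : ∀ Y {μ} → Y ≈ main μ → toH Y ≡ main zero
    main-rigid (chainW a) {μ} r = contradiction (chain-rigid a (main μ) r) λ ()
    main-rigid (counter j) r = refl

    target-tag : ∀ j s t → counterTarget j s ≈ tagNode t → hSlot j s ≡ tag t
    target-tag j s t r = slotNode-injective (trans (sym (toH-target j s)) (tag-rigid _ t r))

    target-main : ∀ j s {μ} → counterTarget j s ≈ main μ → hSlot j s ≡ next zero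
    target-main j s r = slotNode-injective (trans (sym (toH-target j s)) (main-rigid _ r))

    module AtCounter {j μ} (r : counter j ≈ main μ) where

      sp : Spec n Kinds
      sp = spec μ

      out : WSlot → Out Gw (wnode (counter j))
      out s = outW (counterEdge j s)

      out-slot : ∀ (e : Out Gw (wnode (counter j))) → Σ[ s ∈ WSlot ] target Gw (proj₁ e) ≡ wnode (counterTarget j s)
      out-slot e = let s , eq = source-counter _ (outW-source e) in s , cong (wnode ∘ wTarget) eq

      imageSlot : WSlot → Slot n Kinds
      imageSlot s = proj₁ (main-slot r (out s))

      imageSlot-allowed : ∀ s → slotReq sp (imageSlot s) ≢ forbidden
      imageSlot-allowed s forbid =
        not-dead (counterTarget j s) (along (counterEdge j s)
          (subst (λ q → target Gw (proj₁ (out s)) ~ reqTarget q (slotNode (imageSlot s))) forbid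
                 (image-target′ r (out s) (proj₂ (main-slot r (out s))))))

      imageSlot-target : ∀ s → counterTarget j s ≈ slotNode (imageSlot s)
      imageSlot-target s = subst (counterTarget j s ≈_) (reqTarget-allowed (slotReq sp (imageSlot s)) (imageSlot-allowed s))
        (along (counterEdge j s) (image-target′ r (out s) (proj₂ (main-slot r (out s)))))

      tag-allowed : ∀ s t → hSlot j s ≡ tag t → slotReq sp (tag t) ≢ forbidden
      tag-allowed s t eq = go (imageSlot s) (imageSlot-allowed s) (imageSlot-target s)
        where
        tag-injective : ∀ {t t′ : Tag n} → tag {n} {1} t ≡ tag t′ → t ≡ t′
        tag-injective refl = refl
        go : ∀ sl → slotReq sp sl ≢ forbidden → counterTarget j s ≈ slotNode sl → slotReq sp (tag t) ≢ forbidden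
        go (tag t′) allowed t~ =
          subst (λ t → slotReq sp (tag t) ≢ forbidden) (tag-injective (trans (sym (target-tag j s t′ t~)) eq)) allowed
        go (next ν) _       t~ = contradiction (trans (sym eq) (target-main j s t~)) λ ()

      required-target : ∀ sl → slotReq sp sl ≡ required → Σ[ s ∈ WSlot ] counterTarget j s ≈ slotNode sl
      required-target sl req =
        let e , eq = required-preimage (slotEdge μ sl) r (cong reqOccur req)
            s , t≡ = out-slot e
        in s , subst (_~ slotNode sl) t≡ (subst (λ q → target Gw (proj₁ e) ~ reqTarget q (slotNode sl)) req (image-target′ r e eq))

      required-tag : ∀ t → slotReq sp (tag t) ≡ required → ∃ λ s → hSlot j s ≡ tag t
      required-tag t req = let s , t~ = required-target (tag t) req in s , target-tag j s t t~

      bit-required : ∀ i → bitReq sp i ≡ required → lookup (counterBits j) i ≡ true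
      bit-required i req = let s , eq = required-tag (bitTag i true) req in hSlot-bit j s eq

      bit-forbidden : ∀ i → bitReq sp i ≡ forbidden → lookup (counterBits j) i ≡ false
      bit-forbidden i forbid = go _ refl
        where
        go : ∀ b → lookup (counterBits j) i ≡ b → lookup (counterBits j) i ≡ false
        go true  bi = contradiction forbid (tag-allowed (bitOut i) (bitTag i true) (cong (bit i) bi))
        go false bi = bi

      bit-present : ∀ i b → bitReq sp i ≡ present b → lookup (counterBits j) i ≡ b
      bit-present i true  = bit-required i
      bit-present i false = bit-forbidden i

      end-required : endReq sp ≡ required → IsLast j
      end-required req = let s , eq = required-tag endTag req in hSlot-end j s eq

      end-forbidden : endReq sp ≡ forbidden → suc (toℕ j) < 2 ^ n
      end-forbidden forbid = go (suc (toℕ j) <? 2 ^ n)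
        where
        go : Dec (suc (toℕ j) < 2 ^ n) → suc (toℕ j) < 2 ^ n
        go (yes lt)   = lt
        go (no last) = contradiction forbid (tag-allowed lastOut endTag (last-end j last))

      next-required : ∀ ν → nextReq sp ν ≡ required → Σ[ lt ∈ suc (toℕ j) < 2 ^ n ] counter (fromℕ< lt) ≈ main ν
      next-required ν req =
        let s , t~ = required-target (next ν) req
            lt , t≡ = hSlot-next j s (target-main j s t~)
        in lt , subst (_≈ main ν) t≡ t~

      next-allowed : ∀ (lt : suc (toℕ j) < 2 ^ n) → Σ[ ν ∈ Fin Kinds ] nextReq sp ν ≢ forbidden × counter (fromℕ< lt) ≈ main ν
      next-allowed lt = go (imageSlot lastOut) (imageSlot-allowed lastOut) (imageSlot-target lastOut)
        where
        go : ∀ sl → slotReq sp sl ≢ forbidden → counterTarget j lastOut ≈ slotNode sl →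
             Σ[ ν ∈ Fin Kinds ] nextReq sp ν ≢ forbidden × counter (fromℕ< lt) ≈ main ν
        go (tag t)  _       t~ = contradiction (trans (sym (proj₁ (last-next j lt))) (target-tag j lastOut t t~)) λ ()
        go (next ν) allowed t~ = ν , allowed , subst (_≈ main ν) (proj₂ (last-next j lt)) t~

      badTail-forced : sp ≡ badTailSpec →
                       Σ[ lt ∈ suc (toℕ j) < 2 ^ n ] Σ[ ν ∈ Fin Kinds ] T (isBad (kindOf ν)) × counter (fromℕ< lt) ≈ main ν
      badTail-forced sp≡ =
        let ν , allowed , r′ = next-allowed lt in lt , ν , bad-next (subst (λ sp → nextReq sp ν ≢ forbidden) sp≡ allowed) , r′
        where
        lt = end-forbidden (cong endReq sp≡)
        bad-next : ∀ {b} → (if b then optional else forbidden) ≢ forbidden → T b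
        bad-next {true}  _ = tt
        bad-next {false} f = contradiction refl f

      unfinished-forced : ∀ {k} → sp ≡ unfinishedSpec k → IsLast j × lookup (counterBits j) k ≡ false
      unfinished-forced {k} sp≡ =
        end-required (cong endReq sp≡) , bit-forbidden k (trans (cong (λ sp → bitReq sp k) sp≡) (if-yes (k ≟ k) refl))

      noFlip-forced : ∀ {i b k} → sp ≡ noFlipSpec i b k →
                      carry (counterBits j) i ≡ true × lookup (counterBits j) i ≡ b ×
                      Σ[ lt ∈ suc (toℕ j) < 2 ^ n ] counter (fromℕ< lt) ≈ main (kindIndex (successor i b k))
      noFlip-forced {i} {b} {k} sp≡ =
        carry-true⇐ (counterBits j) i (λ j′ j′<i → bit-required j′ (req (λ sp → bitReq sp j′) (if-yes (toℕ j′ <? toℕ i) j′<i))) ,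
        bit-present i b (req (λ sp → bitReq sp i) (trans (if-no (toℕ i <? toℕ i) {required} (<-irrefl refl)) (if-yes (i ≟ i) refl))) ,
        next-required ν₀ (req (λ sp → nextReq sp ν₀) (if-yes (ν₀ ≟ ν₀) refl))
        where
        ν₀ = kindIndex (successor i b k)
        req : ∀ {q} (f : Spec n Kinds → Req) → f (noFlipSpec i b k) ≡ q → f sp ≡ q
        req f eq = trans (cong f sp≡) eq

      spuriousFlip-forced : ∀ {i k' b k} → toℕ k' < toℕ i → sp ≡ spuriousFlipSpec i k' b k →
                            carry (counterBits j) i ≡ false × lookup (counterBits j) i ≡ b ×
                            Σ[ lt ∈ suc (toℕ j) < 2 ^ n ] counter (fromℕ< lt) ≈ main (kindIndex (successor i (not b) k))
      spuriousFlip-forced {i} {k'} {b} {k} k'<i sp≡ =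
        carry-false⇐ (counterBits j) i k' k'<i (bit-forbidden k' (req (λ sp → bitReq sp k') (if-yes (k' ≟ k') refl))) ,
        bit-present i b (req (λ sp → bitReq sp i) (trans (if-no (i ≟ k') {forbidden} i≢k') (if-yes (i ≟ i) refl))) ,
        next-required ν₀ (req (λ sp → nextReq sp ν₀) (if-yes (ν₀ ≟ ν₀) refl))
        where
        ν₀ = kindIndex (successor i (not b) k)
        i≢k' : i ≢ k'
        i≢k' i≡k' = <-irrefl (cong toℕ (sym i≡k')) k'<i
        req : ∀ {q} (f : Spec n Kinds → Req) → f (spuriousFlipSpec i k' b k) ≡ q → f sp ≡ q
        req f eq = trans (cong f sp≡) eq

    last⇒full : ∀ j → IsLast j → suc (toℕ j) ≡ 2 ^ n
    last⇒full j last = ≤∧≮⇒≡ (toℕ<n j) last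

    bits-successor : ∀ j (lt : suc (toℕ j) < 2 ^ n) → counterBits (fromℕ< lt) ≡ increment (counterBits j)
    bits-successor j lt = trans (cong (toBits n) (toℕ-fromℕ< lt)) (toBits-suc n (toℕ j))

    successor-spec : ∀ i c k → spec (kindIndex (successor i c k)) ≡ (if successorValid i c k then successorSpec i c k else badTailSpec)
    successor-spec i c k = cong specKind (decode-encode finiteKind (successor i c k))

    -- Along the next edges of the witness a bad specification is passed on until it
    -- demands a defect that the counter does not have; d is the distance to the last node.
    badSpec-rejected : ∀ d j → suc (toℕ j) + d ≡ 2 ^ n → ∀ μ → counter j ≈ main μ →
                       ∀ {sp} → BadSpec sp → spec μ ≡ sp → ⊥
    badSpec-rejected d j dist μ r = reject
      where
      open AtCounter r

      onward : (lt : suc (toℕ j) < 2 ^ n) → ∀ ν → counter (fromℕ< lt) ≈ main ν → ∀ {sp} → BadSpec sp → spec ν ≡ sp → ⊥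
      onward lt ν r′ bad′ sp≡′ = go d dist
        where
        go : ∀ d → suc (toℕ j) + d ≡ 2 ^ n → ⊥
        go zero    dist′ = <-irrefl (trans (sym (+-identityʳ _)) dist′) lt
        go (suc d) dist′ = badSpec-rejected d (fromℕ< lt)
          (trans (cong (λ x → suc x + d) (toℕ-fromℕ< lt)) (trans (sym (+-suc (suc (toℕ j)) d)) dist′)) ν r′ bad′ sp≡′

      successor-rejected : (lt : suc (toℕ j) < 2 ^ n) → ∀ i c k → counter (fromℕ< lt) ≈ main (kindIndex (successor i c k)) →
                           lookup (counterBits (fromℕ< lt)) i ≢ c → ⊥
      successor-rejected lt i c k r′ ≢c = checked (successorValid i c k) (successor-spec i c k)
        where
        checked : ∀ v → spec (kindIndex (successor i c k)) ≡ (if v then successorSpec i c k else badTailSpec) → ⊥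
        checked true  sp≡ = ≢c (AtCounter.bit-present r′ i c (trans (cong (λ sp → bitReq sp i) sp≡) (if-yes (i ≟ i) refl)))
        checked false sp≡ = onward lt _ r′ badTail sp≡

      reject : ∀ {sp} → BadSpec sp → spec μ ≡ sp → ⊥
      reject badTail sp≡ = let lt , ν , isbad , r′ = badTail-forced sp≡ in onward lt ν r′ (isBad⇒BadSpec (kindOf ν) isbad) refl
      reject (unfinished k) sp≡ = let last , bk = unfinished-forced sp≡ in
        contradiction (trans (sym bk) (toBits-last n (toℕ j) (last⇒full j last) k)) λ ()
      reject (noFlip i b k) sp≡ = let carried , bi , lt , r′ = noFlip-forced sp≡ in
        successor-rejected lt i b k r′ λ next-i → not-¬ refl (trans (sym next-i)
          (trans (cong (λ v → lookup v i) (bits-successor j lt)) (trans (increment-carry (counterBits j) i carried) (cong not bi))))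
      reject (spuriousFlip i k' b k k'<i) sp≡ = let uncarried , bi , lt , r′ = spuriousFlip-forced k'<i sp≡ in
        successor-rejected lt i (not b) k r′ λ next-i → not-¬ refl (trans (sym
          (trans (cong (λ v → lookup v i) (bits-successor j lt)) (trans (increment-noCarry (counterBits j) i uncarried) bi))) next-i)

    -- The root of the witness represents 0, so no main node of K simulates it: the
    -- good kinds require a set bit, the bad ones are refuted above.
    root-rejected : (pos : 0 < 2 ^ n) → ∀ μ → counter (fromℕ< pos) ≈ main μ → ⊥
    root-rejected pos μ r = reject (kindOf μ) refl
      where
      open AtCounter r
      root = fromℕ< pos

      unset : ∀ i → lookup (counterBits root) i ≢ true
      unset i set = contradiction
        (trans (sym set) (trans (cong (λ x → lookup (toBits n x) i) (toℕ-fromℕ< pos)) (toBits-zero n i))) λ ()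

      dist : suc (toℕ root) + (2 ^ n ∸ 1) ≡ 2 ^ n
      dist = trans (cong (λ x → suc x + (2 ^ n ∸ 1)) (toℕ-fromℕ< pos)) (m+[n∸m]≡n pos)

      bad : ∀ {κ} → kindOf μ ≡ κ → T (isBad κ) → ⊥
      bad {κ} κ≡ isbad = badSpec-rejected (2 ^ n ∸ 1) root dist μ r (isBad⇒BadSpec κ isbad) (cong specKind κ≡)

      reject : ∀ κ → kindOf μ ≡ κ → ⊥
      reject (nonzero k) κ≡ = unset k (bit-required k (trans (cong (λ κ → bitReq (specKind κ) k) κ≡) (if-yes (k ≟ k) refl)))
      reject (successor i true k) κ≡ =
        unset i (bit-required i (trans (cong (λ κ → bitReq (specKind κ) i) κ≡) (if-yes (i ≟ i) refl)))
      reject (successor i false k) κ≡ = checked (k ≟ i) (cong specKind κ≡)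
        where
        checked : (k≟i : Dec (k ≡ i)) → spec μ ≡ (if not (does k≟i) then successorSpec i false k else badTailSpec) → ⊥
        checked (yes _)   sp≡ = badSpec-rejected (2 ^ n ∸ 1) root dist μ r badTail sp≡
        checked (no k≢i)  sp≡ = unset k (bit-required k
          (trans (cong (λ sp → bitReq sp k) sp≡) (trans (if-no (k ≟ i) {present false} k≢i) (if-yes (k ≟ k) refl))))
      reject κ@(unfinished _)         κ≡ = bad κ≡ tt
      reject κ@badTail                κ≡ = bad κ≡ tt
      reject κ@(noFlip _ _ _)         κ≡ = bad κ≡ tt
      reject κ@(spuriousFlip _ _ _ _) κ≡ = bad κ≡ tt

    root-unsimulated : ∀ x → R (wnode (counter (fromℕ< (m^n>0 2 n)))) x → ⊥
    root-unsimulated x rel = unsimulated (decode nodes x) ⟨ subst (R _) (sym (encode-decode nodes x)) rel ⟩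
      where
      unsimulated : ∀ X → counter (fromℕ< (m^n>0 2 n)) ≈ X → ⊥
      unsimulated (chain a) r = counter-notChain r
      unsimulated dead      r = counter-notDead r
      unsimulated (main μ)  r = root-rejected (m^n>0 2 n) μ r

  Gw∉K : ¬ Gw ∈L K
  Gw∉K (_ , R , sim , total) = let x , root~x = total (wnode (counter (fromℕ< (m^n>0 2 n)))) in root-unsimulated sim x root~x


-- Sizes

data Poly : Set where
  con     : ℕ → Poly
  var     : Poly
  _⊞_ _⊠_ : Poly → Poly → Poly

⟦_⟧ : Poly → ℕ → ℕ
⟦ con k ⟧ n = k
⟦ var ⟧   n = n
⟦ p ⊞ q ⟧ n = ⟦ p ⟧ n + ⟦ q ⟧ n
⟦ p ⊠ q ⟧ n = ⟦ p ⟧ n * ⟦ q ⟧ n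

degree : Poly → ℕ
degree (con _) = 0
degree var     = 1
degree (p ⊞ q) = degree p ⊔ degree q
degree (p ⊠ q) = degree p + degree q

-- ⟦ p ⟧ 1 is the sum of the coefficients of p.
⟦⟧≤ : ∀ p {n} → 1 ≤ n → ⟦ p ⟧ n ≤ ⟦ p ⟧ 1 * n ^ degree p
⟦⟧≤ (con k) _ = subst (k ≤_) (sym (*-identityʳ k)) ≤-refl
⟦⟧≤ var {n} _ = subst (n ≤_) (sym (*-identityˡ (n * 1))) (subst (n ≤_) (sym (*-identityʳ n)) ≤-refl)
⟦⟧≤ (p ⊞ q) {suc n} 1≤n = begin
  ⟦ p ⟧ N + ⟦ q ⟧ N                                ≤⟨ +-mono-≤ (⟦⟧≤ p 1≤n) (⟦⟧≤ q 1≤n) ⟩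
  ⟦ p ⟧ 1 * N ^ degree p + ⟦ q ⟧ 1 * N ^ degree q  ≤⟨ +-mono-≤ (*-monoʳ-≤ (⟦ p ⟧ 1) (^-monoʳ-≤ N (m≤m⊔n (degree p) (degree q))))
                                                                (*-monoʳ-≤ (⟦ q ⟧ 1) (^-monoʳ-≤ N (m≤n⊔m (degree p) (degree q)))) ⟩
  ⟦ p ⟧ 1 * N ^ d + ⟦ q ⟧ 1 * N ^ d                ≡⟨ sym (*-distribʳ-+ (N ^ d) (⟦ p ⟧ 1) (⟦ q ⟧ 1)) ⟩
  (⟦ p ⟧ 1 + ⟦ q ⟧ 1) * N ^ d                      ∎
  where
  open ≤-Reasoning
  N = suc n
  d = degree p ⊔ degree q
⟦⟧≤ (p ⊠ q) {n} 1≤n = begin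
  ⟦ p ⟧ n * ⟦ q ⟧ n                                    ≤⟨ *-mono-≤ (⟦⟧≤ p 1≤n) (⟦⟧≤ q 1≤n) ⟩
  (⟦ p ⟧ 1 * n ^ degree p) * (⟦ q ⟧ 1 * n ^ degree q)  ≡⟨ [m*n]*[o*p]≡[m*o]*[n*p] (⟦ p ⟧ 1) _ (⟦ q ⟧ 1) _ ⟩
  (⟦ p ⟧ 1 * ⟦ q ⟧ 1) * (n ^ degree p * n ^ degree q)  ≡⟨ cong (⟦ p ⟧ 1 * ⟦ q ⟧ 1 *_) (sym (^-distribˡ-+-* n (degree p) (degree q))) ⟩
  (⟦ p ⟧ 1 * ⟦ q ⟧ 1) * n ^ (degree p + degree q)      ∎
  where open ≤-Reasoning

chainLengthP : Poly
chainLengthP = con 2 ⊞ ((var ⊠ con 2) ⊞ con 1)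

shapeSizeP : Poly → Poly
shapeSizeP M = (chainLengthP ⊞ (con 1 ⊞ M)) ⊞ ((con 1 ⊞ ((var ⊠ con 2) ⊞ con 1)) ⊞ (con 1 ⊞ (M ⊠ (chainLengthP ⊞ M))))

kindsP : Poly
kindsP = var ⊞ (var ⊞ (con 1 ⊞ (n2n ⊞ ((var ⊠ n2n) ⊞ n2n))))
  where n2n = var ⊠ (con 2 ⊠ var)

size-H : ∀ s n → size (GraphH.H s n) ≡ ⟦ shapeSizeP (con 1) ⟧ n
size-H s n = refl

size-K : ∀ s n → size (GraphK.K s n) ≡ ⟦ shapeSizeP kindsP ⟧ n
size-K s n = refl

⟦⟧≤-uniform : ∀ p {C d n} → 1 ≤ n → ⟦ p ⟧ 1 ≤ C → degree p ≤ d → ⟦ p ⟧ n ≤ C * n ^ d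
⟦⟧≤-uniform p {n = suc n} 1≤n p1≤C deg≤d = ≤-trans (⟦⟧≤ p 1≤n) (*-mono-≤ p1≤C (^-monoʳ-≤ (suc n) deg≤d))

lemma3 : (s : ℕ) → 1 ≤ s →
    Σ[ p ∈ ℕ ] Σ[ q ∈ ℕ ] (1 ≤ p) × (1 ≤ q) ×
    Σ[ C ∈ ℕ ] Σ[ d ∈ ℕ ]
    (∀ (n : ℕ) → 1 ≤ n →
      Σ[ H ∈ Graph s ] Σ[ K ∈ Graph s ]
        IsShape H × IsShape K ×
        size H ≤ C * n ^ d × size K ≤ C * n ^ d ×
        (Σ[ G ∈ Graph s ] (G ∈L H) × ¬ (G ∈L K)) ×
        (∀ (G : Graph s) → G ∈L H → ¬ (G ∈L K) → 2 ^ (p * n) ≤ size G ^ q))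
lemma3 (suc s) _ = 1 , 1 , ≤-refl , ≤-refl , C , 6 , λ n 1≤n →
    GraphH.H s n , GraphK.K s n , GraphH.graph-shape s n , GraphK.graph-shape s n ,
    ≤-trans (≤-reflexive (size-H s n)) (⟦⟧≤-uniform (shapeSizeP (con 1)) {d = 6} 1≤n (m≤m+n cH cK) (s≤s z≤n)) ,
    ≤-trans (≤-reflexive (size-K s n)) (⟦⟧≤-uniform (shapeSizeP kindsP) {d = 6} 1≤n (m≤n+m cK cH) ≤-refl) ,
    (Witness.Gw s n , Witness.IntoH.Gw∈H s n , NotInK.Gw∉K s n) ,
    λ G G∈H G∉K →
      subst₂ _≤_ (cong (2 ^_) (sym (*-identityˡ n))) (sym (^-identityʳ (size G))) (∉K⇒large s n G G∈H G∉K)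
  where
  cH = ⟦ shapeSizeP (con 1) ⟧ 1
  cK = ⟦ shapeSizeP kindsP ⟧ 1
  C = cH + cK
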